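{- Let $p \geq 5$ be a prime and let $S_p(0) = \{ n \in \mathbb{N} : M_n \equiv 0 \pmod p\}$. Then the asymptotic density of $S_p(0)$ is at least $\frac{2}{p(p-1)}$; that is, $$\liminf_{N \to \infty} \frac{1}{N}\, \#\{ n \in S_p(0) : n \leq N\} \geq \frac{2}{p(p-1)}.$$
   Context: The Motzkin numbers are $M_n = \sum_{k \geq 0} \binom{n}{2k} C_k$, where $C_k = \frac{1}{k+1}\binom{2k}{k}$ are the Catalan numbers. The asymptotic density of $S \subseteq \mathbb{N}$ is $\lim_{N\to\infty} \frac1N \#\{n \in S : n \le N\}$ when the limit exists. -}

module Defs where

open import Data.Nat using (ℕ; zero; suc; _+_; _*_; _/_)
open import Data.Nat.Combinatorics using (_C_)
open import Data.Nat.Divisibility using (_∣?_)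
open import Data.Integer using (+_)
open import Data.Rational using (ℚ; 0ℚ) renaming (_/_ to _/ℚ_)
open import Relation.Nullary using (yes; no)

-- Catalan number C_k = (1/(k+1)) * binom(2k, k)  (exact division in ℕ)
catalan : ℕ → ℕ
catalan k = ((2 * k) C k) / suc k

sumTo : ℕ → (ℕ → ℕ) → ℕ
sumTo zero    f = f 0
sumTo (suc K) f = sumTo K f + f (suc K)

-- Motzkin number M_n = Σ_{k ≥ 0} binom(n, 2k) C_k ; terms with 2k > n vanish,
-- so summing k = 0..n covers all nonzero terms.
motzkin : ℕ → ℕ
motzkin n = sumTo n (λ k → (n C (2 * k)) * catalan k)

countS0 : ℕ → ℕ → ℕ
countS0 p zero with p ∣? motzkin 0
... | yes _ = 1
... | no  _ = 0
countS0 p (suc N) with p ∣? motzkin (suc N)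
... | yes _ = suc (countS0 p N)
... | no  _ = countS0 p N

-- the rational number 2 / (p (p - 1)) (for p ≥ 2; junk value 0 otherwise)
lowerBound : ℕ → ℚ
lowerBound (suc (suc q)) = (+ 2) /ℚ (suc (suc q) * suc q)
lowerBound _ = 0ℚ

module Submission where

-- Write T(n, j) for the coefficient of x^j in (x⁻¹ + 1 + x)^n. Since C_k = C(2k, k) − C(2k, k + 1),
-- M_n = T(n, 0) − T(n, 2). Modulo p, (x⁻¹ + 1 + x)^p ≡ x⁻ᵖ + 1 + xᵖ gives the Lucas-type rule
-- T(pN + s, r) ≡ T(N, 0) T(s, r) + T(N, 1) T(s, r − p) for digits s, r < p. So if n ends in the
-- base-p digit p − 1 or p − 2, then M_n ≡ x T(N, 0) + y T(N, 1) with N = ⌊n/p⌋; a further digit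
-- p − 1 changes (x, y) linearly, and a suitable stop digit s < p − 1 makes the form vanish. The
-- values of T(p − 1, ·), T(p − 2, ·), T(p − 3, ·) needed for this come from
-- (1 + x + x²)^(p − k) ≡ (1 + x + x²)^(−k) in low degrees and depend on p mod 3. Hence p ∣ M_n
-- whenever n ends in a stop digit, then digits p − 1, then p − 1 or p − 2, a set of density
-- (2/p) · (1/p) · (1 + 1/p + 1/p² + ⋯) = 2/(p(p − 1)).

open import Data.Nat using (ℕ; suc)
open import Data.Nat.Primality using (Prime)

module Binomial where

  open import Data.Nat using (ℕ; zero; suc; _+_; _*_; _∸_; _<_; _≤_; _/_; s≤s)
  open import Data.Nat.Properties
  open import Data.Nat.Combinatorics using (_C_; nCk+nC[k+1]≡[n+1]C[k+1]; nCk≡nC[n∸k])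
  open import Data.Nat.DivMod using (m*n/n≡m)
  open import Data.Nat.Tactic.RingSolver using (solve-∀)
  open import Relation.Binary.PropositionalEquality
  open import Defs using (catalan)

  binom : ℕ → ℕ → ℕ
  binom n       zero    = 1
  binom zero    (suc k) = 0
  binom (suc n) (suc k) = binom n k + binom n (suc k)

  C≡binom : ∀ n k → n C k ≡ binom n k
  C≡binom n       zero    = refl
  C≡binom zero    (suc k) = refl
  C≡binom (suc n) (suc k) = trans (sym (nCk+nC[k+1]≡[n+1]C[k+1] n k))
                                  (cong₂ _+_ (C≡binom n k) (C≡binom n (suc k)))

  binom-sym : ∀ {n k} → k ≤ n → binom n k ≡ binom n (n ∸ k)
  binom-sym {n} {k} k≤n = trans (sym (C≡binom n k)) (trans (nCk≡nC[n∸k] k≤n) (C≡binom n (n ∸ k)))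

  n<k⇒binom≡0 : ∀ {n k} → n < k → binom n k ≡ 0
  n<k⇒binom≡0 {zero}  {suc k} _         = refl
  n<k⇒binom≡0 {suc n} {suc k} (s≤s n<k) = cong₂ _+_ (n<k⇒binom≡0 n<k) (n<k⇒binom≡0 (m<n⇒m<1+n n<k))

  binom-diag : ∀ n → binom n n ≡ 1
  binom-diag zero    = refl
  binom-diag (suc n) = cong₂ _+_ (binom-diag n) (n<k⇒binom≡0 (n<1+n n))

  binom-absorb : ∀ n k → suc k * binom (suc n) (suc k) ≡ suc n * binom n k
  binom-absorb zero    zero    = refl
  binom-absorb zero    (suc k) = *-zeroʳ (suc (suc k))
  binom-absorb (suc n) zero    = cong suc (trans (+-identityʳ (binom (suc n) 1)) (trans (sym (+-identityʳ _)) (binom-absorb n 0)))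
  binom-absorb (suc n) (suc k) = begin
    suc (suc k) * (a + b)                     ≡⟨ split k a b ⟩
    suc k * a + a + suc (suc k) * b           ≡⟨ cong₂ (λ x y → x + a + y) (binom-absorb n k) (binom-absorb n (suc k)) ⟩
    suc n * binom n k + a + suc n * binom n (suc k) ≡⟨ merge n (binom n k) a (binom n (suc k)) ⟩
    a + suc n * (binom n k + binom n (suc k)) ≡⟨ collect n a ⟩
    suc (suc n) * a                           ∎
    where
      open ≡-Reasoning
      a : ℕ
      a = binom (suc n) (suc k)
      b : ℕ
      b = binom (suc n) (suc (suc k))
      split : ∀ k a b → suc (suc k) * (a + b) ≡ suc k * a + a + suc (suc k) * b
      split = solve-∀
      merge : ∀ n x a y → suc n * x + a + suc n * y ≡ a + suc n * (x + y)
      merge = solve-∀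
      collect : ∀ n a → a + suc n * a ≡ suc (suc n) * a
      collect = solve-∀

  catalan+binom≡binom : ∀ k → catalan k + binom (2 * k) (suc k) ≡ binom (2 * k) k
  catalan+binom≡binom k = begin
    catalan k + Y             ≡⟨ cong (λ z → z / suc k + Y) (trans (C≡binom (2 * k) k) (sym quotient)) ⟩
    (X ∸ Y) * suc k / suc k + Y ≡⟨ cong (_+ Y) (m*n/n≡m (X ∸ Y) (suc k)) ⟩
    X ∸ Y + Y                 ≡⟨ m∸n+n≡m Y≤X ⟩
    X                         ∎
    where
      open ≡-Reasoning
      X : ℕ
      X = binom (2 * k) k
      Y : ℕ
      Y = binom (2 * k) (suc k)
      expand : ∀ k X Y → suc k * (X + Y) ≡ suc k * Y + suc k * X
      expand = solve-∀
      split : ∀ k X → suc (2 * k) * X ≡ k * X + suc k * X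
      split = solve-∀
      [k+1]Y≡kX : suc k * Y ≡ k * X
      [k+1]Y≡kX = +-cancelʳ-≡ _ _ _ (trans (sym (expand k X Y)) (trans (binom-absorb (2 * k) k) (split k X)))
      Y≤X : Y ≤ X
      Y≤X = *-cancelˡ-≤ (suc k) (subst (_≤ suc k * X) (sym [k+1]Y≡kX) (m≤n+m (k * X) X))
      distrib : ∀ k Z Y → suc k * (Z + Y) ≡ suc k * Z + suc k * Y
      distrib = solve-∀
      peel : ∀ k X → suc k * X ≡ X + k * X
      peel = solve-∀
      quotient : (X ∸ Y) * suc k ≡ X
      quotient = trans (*-comm (X ∸ Y) (suc k)) (+-cancelʳ-≡ _ _ _ (begin
        suc k * (X ∸ Y) + k * X           ≡⟨ cong (suc k * (X ∸ Y) +_) (sym [k+1]Y≡kX) ⟩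
        suc k * (X ∸ Y) + suc k * Y       ≡⟨ sym (distrib k (X ∸ Y) Y) ⟩
        suc k * (X ∸ Y + Y)               ≡⟨ cong (suc k *_) (m∸n+n≡m Y≤X) ⟩
        suc k * X                         ≡⟨ peel k X ⟩
        X + k * X                         ∎))

module Sums where

  open import Data.Nat using (ℕ; zero; suc; _+_; _*_)
  open import Data.Nat.Properties using (+-assoc; *-distribˡ-+)
  open import Data.Nat.Tactic.RingSolver using (solve-∀)
  open import Relation.Binary.PropositionalEquality
  open import Defs using (sumTo)

  sumTo-cong : ∀ B {f g : ℕ → ℕ} → (∀ k → f k ≡ g k) → sumTo B f ≡ sumTo B g
  sumTo-cong zero    f≡g = f≡g 0
  sumTo-cong (suc B) f≡g = cong₂ _+_ (sumTo-cong B f≡g) (f≡g (suc B))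

  sumTo-+ : ∀ B (f g : ℕ → ℕ) → sumTo B (λ k → f k + g k) ≡ sumTo B f + sumTo B g
  sumTo-+ zero    f g = refl
  sumTo-+ (suc B) f g = trans (cong (_+ (f (suc B) + g (suc B))) (sumTo-+ B f g))
                              (interchange (sumTo B f) (sumTo B g) (f (suc B)) (g (suc B)))
    where
      interchange : ∀ a b c d → a + b + (c + d) ≡ a + c + (b + d)
      interchange = solve-∀

  sumTo-*ˡ : ∀ B c (f : ℕ → ℕ) → sumTo B (λ k → c * f k) ≡ c * sumTo B f
  sumTo-*ˡ zero    c f = refl
  sumTo-*ˡ (suc B) c f = trans (cong (_+ c * f (suc B)) (sumTo-*ˡ B c f)) (sym (*-distribˡ-+ c _ _))

  sumTo-suc : ∀ B (f : ℕ → ℕ) → sumTo (suc B) f ≡ f 0 + sumTo B (λ k → f (suc k))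
  sumTo-suc zero    f = refl
  sumTo-suc (suc B) f = trans (cong (_+ f (suc (suc B))) (sumTo-suc B f)) (+-assoc (f 0) _ _)

  delayed : (ℕ → ℕ) → ℕ → ℕ
  delayed f zero    = 0
  delayed f (suc k) = f k

  sumTo-delayed : ∀ B (f : ℕ → ℕ) → sumTo (suc B) (delayed f) ≡ sumTo B f
  sumTo-delayed B f = sumTo-suc B (delayed f)

  sumTo-≡0 : ∀ B (f : ℕ → ℕ) → (∀ k → f k ≡ 0) → sumTo B f ≡ 0
  sumTo-≡0 zero    f f≡0 = f≡0 0
  sumTo-≡0 (suc B) f f≡0 = cong₂ _+_ (sumTo-≡0 B f f≡0) (f≡0 (suc B))

module TrinomialSum where

  open import Data.Nat using (ℕ; zero; suc; _+_; _*_; _∸_; _<_; _≤_; s≤s)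
  open import Data.Nat.Properties
  open import Data.Nat.Combinatorics using (_C_)
  open import Data.Nat.Tactic.RingSolver using (solve-∀)
  open import Relation.Binary.PropositionalEquality
  open import Defs using (catalan; sumTo; motzkin)

  open Binomial
  open Sums

  -- Words of length n over {−1, 0, 1} with letter sum i and k letters −1:
  -- choose the i + 2k nonzero positions, then the k negative ones among them.
  trinomialTerm : ℕ → ℕ → ℕ → ℕ
  trinomialTerm n i k = binom n (i + 2 * k) * binom (i + 2 * k) k

  trinomialSum : ℕ → ℕ → ℕ → ℕ
  trinomialSum B n i = sumTo B (trinomialTerm n i)

  2*suc : ∀ k → 2 * suc k ≡ 2 + 2 * k
  2*suc = solve-∀

  n<2*suc : ∀ n → n < 2 * suc n
  n<2*suc n = s≤s (m≤m+n n (suc (n + 0)))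

  motzkin+trinomialSum≡trinomialSum : ∀ n → motzkin n + trinomialSum n n 2 ≡ trinomialSum n n 0
  motzkin+trinomialSum≡trinomialSum n = sym (begin
    trinomialSum n n 0                                ≡⟨ sumTo-cong n split ⟩
    sumTo n (λ k → (n C (2 * k)) * catalan k + g k)   ≡⟨ sumTo-+ n _ g ⟩
    motzkin n + sumTo n g                             ≡⟨ cong (motzkin n +_) shifted ⟩
    motzkin n + trinomialSum n n 2                    ∎)
    where
      open ≡-Reasoning
      g : ℕ → ℕ
      g k = binom n (2 * k) * binom (2 * k) (suc k)
      split : ∀ k → trinomialTerm n 0 k ≡ (n C (2 * k)) * catalan k + g k
      split k = begin
        binom n (2 * k) * binom (2 * k) k                           ≡⟨ cong (binom n (2 * k) *_) (sym (catalan+binom≡binom k)) ⟩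
        binom n (2 * k) * (catalan k + binom (2 * k) (suc k))       ≡⟨ *-distribˡ-+ (binom n (2 * k)) _ _ ⟩
        binom n (2 * k) * catalan k + g k                           ≡⟨ cong (λ z → z * catalan k + g k) (sym (C≡binom n (2 * k))) ⟩
        (n C (2 * k)) * catalan k + g k                             ∎
      g-suc : ∀ k → g (suc k) ≡ trinomialTerm n 2 k
      g-suc k = begin
        binom n (2 * suc k) * binom (2 * suc k) (2 + k)       ≡⟨ cong (λ m → binom n m * binom m (2 + k)) (2*suc k) ⟩
        binom n (2 + 2 * k) * binom (2 + 2 * k) (2 + k)       ≡⟨ cong (binom n (2 + 2 * k) *_) (binom-sym 2+k≤) ⟩
        binom n (2 + 2 * k) * binom (2 + 2 * k) (2 + 2 * k ∸ (2 + k)) ≡⟨ cong (λ j → binom n (2 + 2 * k) * binom (2 + 2 * k) j) complement ⟩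
        trinomialTerm n 2 k                                   ∎
        where
          2+2k≡[2+k]+k : 2 + 2 * k ≡ (2 + k) + k
          2+2k≡[2+k]+k = regroup k
            where
              regroup : ∀ k → 2 + 2 * k ≡ (2 + k) + k
              regroup = solve-∀
          2+k≤ : 2 + k ≤ 2 + 2 * k
          2+k≤ = subst (2 + k ≤_) (sym 2+2k≡[2+k]+k) (m≤m+n (2 + k) k)
          complement : 2 + 2 * k ∸ (2 + k) ≡ k
          complement = trans (cong (_∸ (2 + k)) 2+2k≡[2+k]+k) (m+n∸m≡n (2 + k) k)
      shifted : sumTo n g ≡ trinomialSum n n 2
      shifted = begin
        sumTo n g                            ≡⟨ sym (+-identityʳ _) ⟩
        sumTo n g + 0                        ≡⟨ cong (sumTo n g +_) (sym (cong (_* binom (2 * suc n) (2 + n)) (n<k⇒binom≡0 (n<2*suc n)))) ⟩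
        sumTo (suc n) g                      ≡⟨ sumTo-suc n g ⟩
        g 0 + sumTo n (λ k → g (suc k))      ≡⟨ sumTo-cong n g-suc ⟩
        trinomialSum n n 2                   ∎

  trinomialTerm-pascal : ∀ n i k → trinomialTerm (suc n) (suc i) k
    ≡ trinomialTerm n i k + trinomialTerm n (suc i) k + delayed (trinomialTerm n (2 + i)) k
  trinomialTerm-pascal n i zero = expand (binom n (i + 0)) (binom n (suc (i + 0)))
    where
      expand : ∀ a b → (a + b) * 1 ≡ a * 1 + b * 1 + 0
      expand = solve-∀
  trinomialTerm-pascal n i (suc k) = begin
    (binom n m + binom n (suc m)) * (binom m k + binom m (suc k))
      ≡⟨ expand (binom n m) (binom n (suc m)) (binom m k) (binom m (suc k)) ⟩
    binom n m * binom m (suc k) + binom n (suc m) * binom (suc m) (suc k) + binom n m * binom m k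
      ≡⟨ cong (λ j → trinomialTerm n i (suc k) + trinomialTerm n (suc i) (suc k) + binom n j * binom j k) (i+2*suc i k) ⟩
    trinomialTerm n i (suc k) + trinomialTerm n (suc i) (suc k) + trinomialTerm n (2 + i) k ∎
    where
      open ≡-Reasoning
      m : ℕ
      m = i + 2 * suc k
      expand : ∀ a b c d → (a + b) * (c + d) ≡ a * d + b * (c + d) + a * c
      expand = solve-∀
      i+2*suc : ∀ i k → i + 2 * suc k ≡ 2 + i + 2 * k
      i+2*suc = solve-∀

  trinomialSum-pascal : ∀ B n i → trinomialSum (suc B) (suc n) (suc i)
    ≡ trinomialSum (suc B) n i + trinomialSum (suc B) n (suc i) + trinomialSum B n (2 + i)
  trinomialSum-pascal B n i = begin
    trinomialSum (suc B) (suc n) (suc i)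
      ≡⟨ sumTo-cong (suc B) (trinomialTerm-pascal n i) ⟩
    sumTo (suc B) (λ k → trinomialTerm n i k + trinomialTerm n (suc i) k + delayed (trinomialTerm n (2 + i)) k)
      ≡⟨ sumTo-+ (suc B) _ _ ⟩
    sumTo (suc B) (λ k → trinomialTerm n i k + trinomialTerm n (suc i) k) + sumTo (suc B) (delayed (trinomialTerm n (2 + i)))
      ≡⟨ cong₂ _+_ (sumTo-+ (suc B) (trinomialTerm n i) (trinomialTerm n (suc i))) (sumTo-delayed B (trinomialTerm n (2 + i))) ⟩
    trinomialSum (suc B) n i + trinomialSum (suc B) n (suc i) + trinomialSum B n (2 + i) ∎
    where open ≡-Reasoning

  -- At i = 0 the neighbour of index −1 mirrors the one of index 1, hence the factor 2.
  trinomialTerm-pascal₀ : ∀ n k → trinomialTerm (suc n) 0 (suc k) ≡ trinomialTerm n 0 (suc k) + 2 * trinomialTerm n 1 k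
  trinomialTerm-pascal₀ n k = begin
    binom (suc n) (2 * suc k) * binom (2 * suc k) (suc k) ≡⟨ cong (λ m → binom (suc n) m * binom m (suc k)) (2*suc k) ⟩
    (a + b) * (c + binom (suc (2 * k)) (suc k))           ≡⟨ cong (λ z → (a + b) * (c + z)) mirror ⟩
    (a + b) * (c + c)                                     ≡⟨ expand a b c ⟩
    b * (c + c) + 2 * (a * c)
      ≡⟨ cong (_+ 2 * (a * c)) (cong₂ _*_ (cong (binom n) (sym (2*suc k)))
                                          (trans (cong (c +_) (sym mirror)) (cong (λ m → binom m (suc k)) (sym (2*suc k))))) ⟩
    trinomialTerm n 0 (suc k) + 2 * trinomialTerm n 1 k   ∎
    where
      open ≡-Reasoning
      a : ℕ
      a = binom n (suc (2 * k))
      b : ℕ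
      b = binom n (2 + 2 * k)
      c : ℕ
      c = binom (suc (2 * k)) k
      expand : ∀ a b c → (a + b) * (c + c) ≡ b * (c + c) + 2 * (a * c)
      expand = solve-∀
      1+2k≡[1+k]+k : ∀ k → suc (2 * k) ≡ suc k + k
      1+2k≡[1+k]+k = solve-∀
      mirror : binom (suc (2 * k)) (suc k) ≡ c
      mirror = trans (binom-sym (subst (suc k ≤_) (sym (1+2k≡[1+k]+k k)) (m≤m+n (suc k) k)))
                     (cong (binom (suc (2 * k))) (trans (cong (_∸ suc k) (1+2k≡[1+k]+k k)) (m+n∸m≡n (suc k) k)))

  trinomialSum-pascal₀ : ∀ B n → trinomialSum (suc B) (suc n) 0 ≡ trinomialSum (suc B) n 0 + 2 * trinomialSum B n 1
  trinomialSum-pascal₀ B n = begin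
    trinomialSum (suc B) (suc n) 0                              ≡⟨ sumTo-suc B (trinomialTerm (suc n) 0) ⟩
    1 + sumTo B (λ k → trinomialTerm (suc n) 0 (suc k))         ≡⟨ cong (1 +_) (sumTo-cong B (trinomialTerm-pascal₀ n)) ⟩
    1 + sumTo B (λ k → trinomialTerm n 0 (suc k) + 2 * trinomialTerm n 1 k)
      ≡⟨ cong (1 +_) (trans (sumTo-+ B _ _) (cong (sumTo B (λ k → trinomialTerm n 0 (suc k)) +_) (sumTo-*ˡ B 2 (trinomialTerm n 1)))) ⟩
    1 + (sumTo B (λ k → trinomialTerm n 0 (suc k)) + 2 * trinomialSum B n 1)
      ≡⟨ sym (+-assoc 1 (sumTo B (λ k → trinomialTerm n 0 (suc k))) _) ⟩
    1 + sumTo B (λ k → trinomialTerm n 0 (suc k)) + 2 * trinomialSum B n 1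
      ≡⟨ cong (_+ 2 * trinomialSum B n 1) (sym (sumTo-suc B (trinomialTerm n 0))) ⟩
    trinomialSum (suc B) n 0 + 2 * trinomialSum B n 1           ∎
    where open ≡-Reasoning

  trinomialTerm-out : ∀ n i k → n < i + 2 * k → trinomialTerm n i k ≡ 0
  trinomialTerm-out n i k lt = cong (_* binom (i + 2 * k) k) (n<k⇒binom≡0 lt)

  trinomialSum-extend : ∀ B n i → n < i + 2 * suc B → trinomialSum (suc B) n i ≡ trinomialSum B n i
  trinomialSum-extend B n i lt = trans (cong (trinomialSum B n i +_) (trinomialTerm-out n i (suc B) lt)) (+-identityʳ _)

module Trinomial where

  open import Data.Nat as ℕ using (ℕ; zero; suc; z≤n; s≤s)
  import Data.Nat.Properties as ℕ
  open import Data.Integer using (ℤ; +_; -[1+_]; _+_; _-_; -_; 0ℤ; 1ℤ)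
  open import Data.Integer.Tactic.RingSolver using (solve-∀)
  open import Relation.Binary.PropositionalEquality
  import Data.Nat.Tactic.RingSolver as ℕ-Solver
  open import Defs using (motzkin)
  open Sums using (sumTo-≡0)
  open TrinomialSum

  δ : ℤ → ℤ
  δ (+ zero) = 1ℤ
  δ _        = 0ℤ

  -- trinomial n j is the coefficient of x^j in (x⁻¹ + 1 + x)^n.
  trinomial : ℕ → ℤ → ℤ
  trinomial zero    j = δ j
  trinomial (suc n) j = trinomial n (j - 1ℤ) + trinomial n j + trinomial n (j + 1ℤ)

  δ-neg : ∀ j → δ (- j) ≡ δ j
  δ-neg (+ zero)  = refl
  δ-neg (+ suc n) = refl
  δ-neg -[1+ n ]  = refl

  trinomial-neg : ∀ n j → trinomial n (- j) ≡ trinomial n j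
  trinomial-neg zero    j = δ-neg j
  trinomial-neg (suc n) j = begin
    trinomial n (- j - 1ℤ) + trinomial n (- j) + trinomial n (- j + 1ℤ)
      ≡⟨ cong₂ _+_ (cong₂ _+_ (trans (cong (trinomial n) (neg-suc j)) (trinomial-neg n (j + 1ℤ))) (trinomial-neg n j))
                   (trans (cong (trinomial n) (neg-pred j)) (trinomial-neg n (j - 1ℤ))) ⟩
    trinomial n (j + 1ℤ) + trinomial n j + trinomial n (j - 1ℤ)
      ≡⟨ reverse (trinomial n (j + 1ℤ)) (trinomial n j) (trinomial n (j - 1ℤ)) ⟩
    trinomial n (j - 1ℤ) + trinomial n j + trinomial n (j + 1ℤ) ∎
    where
      open ≡-Reasoning
      neg-suc : ∀ j → - j - 1ℤ ≡ - (j + 1ℤ)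
      neg-suc = solve-∀
      neg-pred : ∀ j → - j + 1ℤ ≡ - (j - 1ℤ)
      neg-pred = solve-∀
      reverse : ∀ a b c → a + b + c ≡ c + b + a
      reverse = solve-∀

  private
    n<i+2*suc : ∀ n i → n ℕ.< i ℕ.+ 2 ℕ.* suc n
    n<i+2*suc n i = ℕ.≤-trans (n<2*suc n) (ℕ.m≤n+m _ i)

  trinomial≡trinomialSum : ∀ n i → trinomial n (+ i) ≡ + trinomialSum n n i
  trinomial≡trinomialSum zero zero    = refl
  trinomial≡trinomialSum zero (suc i) = cong (λ m → + (binom 0 m ℕ.* 1)) (sym (ℕ.+-identityʳ (suc i)))
    where open Binomial using (binom)
  trinomial≡trinomialSum (suc n) (suc i) = begin
    trinomial n (+ i) + trinomial n (+ suc i) + trinomial n (+ suc i + 1ℤ)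
      ≡⟨ cong₂ _+_ (cong₂ _+_ (trinomial≡trinomialSum n i) (trinomial≡trinomialSum n (suc i)))
                   (trans (cong (λ m → trinomial n (+ m)) (ℕ.+-comm (suc i) 1)) (trinomial≡trinomialSum n (2 ℕ.+ i))) ⟩
    + (trinomialSum n n i ℕ.+ trinomialSum n n (suc i) ℕ.+ trinomialSum n n (2 ℕ.+ i))
      ≡⟨ cong (λ z → + (z ℕ.+ trinomialSum n n (2 ℕ.+ i)))
              (sym (cong₂ ℕ._+_ (trinomialSum-extend n n i (n<i+2*suc n i)) (trinomialSum-extend n n (suc i) (n<i+2*suc n (suc i))))) ⟩
    + (trinomialSum (suc n) n i ℕ.+ trinomialSum (suc n) n (suc i) ℕ.+ trinomialSum n n (2 ℕ.+ i))
      ≡⟨ cong +_ (sym (trinomialSum-pascal n n i)) ⟩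
    + trinomialSum (suc n) (suc n) (suc i) ∎
    where open ≡-Reasoning
  trinomial≡trinomialSum (suc n) zero = begin
    trinomial n -[1+ 0 ] + trinomial n (+ 0) + trinomial n (+ 1)
      ≡⟨ cong (λ z → z + trinomial n (+ 0) + trinomial n (+ 1)) (trinomial-neg n (+ 1)) ⟩
    trinomial n (+ 1) + trinomial n (+ 0) + trinomial n (+ 1)
      ≡⟨ cong₂ _+_ (cong₂ _+_ (trinomial≡trinomialSum n 1) (trinomial≡trinomialSum n 0)) (trinomial≡trinomialSum n 1) ⟩
    + (trinomialSum n n 1 ℕ.+ trinomialSum n n 0 ℕ.+ trinomialSum n n 1)
      ≡⟨ cong +_ (double (trinomialSum n n 1) (trinomialSum n n 0)) ⟩
    + (trinomialSum n n 0 ℕ.+ 2 ℕ.* trinomialSum n n 1)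
      ≡⟨ cong (λ z → + (z ℕ.+ 2 ℕ.* trinomialSum n n 1)) (sym (trinomialSum-extend n n 0 (n<i+2*suc n 0))) ⟩
    + (trinomialSum (suc n) n 0 ℕ.+ 2 ℕ.* trinomialSum n n 1)
      ≡⟨ cong +_ (sym (trinomialSum-pascal₀ n n)) ⟩
    + trinomialSum (suc n) (suc n) 0 ∎
    where
      open ≡-Reasoning
      double : ∀ a b → a ℕ.+ b ℕ.+ a ≡ b ℕ.+ 2 ℕ.* a
      double = ℕ-Solver.solve-∀

  motzkin≡trinomial₀-trinomial₂ : ∀ n → + motzkin n ≡ trinomial n 0ℤ - trinomial n (+ 2)
  motzkin≡trinomial₀-trinomial₂ n = sym (begin
    trinomial n 0ℤ - trinomial n (+ 2)           ≡⟨ cong₂ _-_ (trinomial≡trinomialSum n 0) (trinomial≡trinomialSum n 2) ⟩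
    + trinomialSum n n 0 - + trinomialSum n n 2  ≡⟨ cong (λ z → + z - + trinomialSum n n 2) (sym (motzkin+trinomialSum≡trinomialSum n)) ⟩
    + motzkin n + + trinomialSum n n 2 - + trinomialSum n n 2 ≡⟨ cancel (+ motzkin n) (+ trinomialSum n n 2) ⟩
    + motzkin n                                  ∎)
    where
      open ≡-Reasoning
      cancel : ∀ a b → a + b - b ≡ a
      cancel = solve-∀

  trinomial-out : ∀ {n i} → n ℕ.< i → trinomial n (+ i) ≡ 0ℤ
  trinomial-out {n} {i} n<i = trans (trinomial≡trinomialSum n i)
    (cong +_ (sumTo-≡0 n (trinomialTerm n i) (λ k → trinomialTerm-out n i k (ℕ.≤-trans n<i (ℕ.m≤m+n i _)))))

  trinomial-out⁻ : ∀ {n i} → n ℕ.< i → trinomial n (- (+ i)) ≡ 0ℤ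
  trinomial-out⁻ {n} {i} n<i = trans (trinomial-neg n (+ i)) (trinomial-out n<i)

  trinomial-top : ∀ n → trinomial n (+ n) ≡ 1ℤ
  trinomial-top zero    = refl
  trinomial-top (suc n) = cong₂ _+_ (cong₂ _+_ (trinomial-top n) (trinomial-out (ℕ.n<1+n n)))
                                    (trinomial-out {n} {suc n ℕ.+ 1} (ℕ.m≤m+n (suc n) 1))

  trinomial-subtop : ∀ n → trinomial (suc n) (+ n) ≡ + suc n
  trinomial-subtop zero    = refl
  trinomial-subtop (suc n) = begin
    trinomial (suc n) (+ n) + trinomial (suc n) (+ suc n) + trinomial (suc n) (+ (suc n ℕ.+ 1))
      ≡⟨ cong₂ _+_ (cong₂ _+_ (trinomial-subtop n) (trinomial-top (suc n))) (trinomial-out (ℕ.m<m+n (suc n) (s≤s z≤n))) ⟩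
    + suc n + 1ℤ + 0ℤ ≡⟨ cong +_ (trans (ℕ.+-identityʳ _) (ℕ.+-comm (suc n) 1)) ⟩
    + suc (suc n)     ∎
    where open ≡-Reasoning

module Congruence (m : ℕ) where

  open import Data.Nat as ℕ using (ℕ; zero; suc)
  import Data.Nat.Properties as ℕ
  import Data.Nat.Divisibility as ℕ
  open import Data.Product using (_×_; _,_; proj₁; proj₂)
  open import Data.Integer as ℤ using (ℤ; +_; _+_; _-_; -_; _*_; 0ℤ)
  import Data.Integer.Properties as ℤ
  open import Data.Integer.Divisibility.Signed
    using (_∣_; divides; ∣ᵤ⇒∣; ∣⇒∣ᵤ; ∣m∣n⇒∣m+n; ∣m⇒∣-m; ∣m⇒∣m*n; ∣n⇒∣m*n)
  open import Data.Integer.Tactic.RingSolver using (solve-∀)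
  open import Relation.Binary.Bundles using (Setoid)
  import Relation.Binary.Reasoning.Setoid
  open import Relation.Binary.PropositionalEquality using (_≡_; refl; sym; subst)

  infix 4 _≈_
  record _≈_ (a b : ℤ) : Set where
    constructor mk≈
    field divides-difference : + m ∣ a - b

  ≈-refl : ∀ {a} → a ≈ a
  ≈-refl {a} = mk≈ (divides 0ℤ (ℤ.+-inverseʳ a))

  ≡⇒≈ : ∀ {a b} → a ≡ b → a ≈ b
  ≡⇒≈ refl = ≈-refl

  ≈-sym : ∀ {a b} → a ≈ b → b ≈ a
  ≈-sym {a} {b} (mk≈ d) = mk≈ (subst (+ m ∣_) (flip a b) (∣m⇒∣-m d))
    where
      flip : ∀ a b → - (a - b) ≡ b - a
      flip = solve-∀

  ≈-trans : ∀ {a b c} → a ≈ b → b ≈ c → a ≈ c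
  ≈-trans {a} {b} {c} (mk≈ d) (mk≈ e) = mk≈ (subst (+ m ∣_) (telescope a b c) (∣m∣n⇒∣m+n d e))
    where
      telescope : ∀ a b c → (a - b) + (b - c) ≡ a - c
      telescope = solve-∀

  +-cong : ∀ {a b c d} → a ≈ b → c ≈ d → a + c ≈ b + d
  +-cong {a} {b} {c} {d} (mk≈ x) (mk≈ y) = mk≈ (subst (+ m ∣_) (regroup a b c d) (∣m∣n⇒∣m+n x y))
    where
      regroup : ∀ a b c d → (a - b) + (c - d) ≡ a + c - (b + d)
      regroup = solve-∀

  *-cong : ∀ {a b c d} → a ≈ b → c ≈ d → a * c ≈ b * d
  *-cong {a} {b} {c} {d} (mk≈ x) (mk≈ y) =
    mk≈ (subst (+ m ∣_) (regroup a b c d) (∣m∣n⇒∣m+n (∣m⇒∣m*n c x) (∣n⇒∣m*n b y)))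
    where
      regroup : ∀ a b c d → (a - b) * c + b * (c - d) ≡ a * c - b * d
      regroup = solve-∀

  -‿cong : ∀ {a b} → a ≈ b → - a ≈ - b
  -‿cong {a} {b} (mk≈ x) = mk≈ (subst (+ m ∣_) (regroup a b) (∣m⇒∣-m x))
    where
      regroup : ∀ a b → - (a - b) ≡ - a - - b
      regroup = solve-∀

  ≈-setoid : Setoid _ _
  ≈-setoid = record { Carrier = ℤ ; _≈_ = _≈_
                  ; isEquivalence = record { refl = ≈-refl ; sym = ≈-sym ; trans = ≈-trans } }

  module ≈-Reasoning = Relation.Binary.Reasoning.Setoid ≈-setoid

  ∣⇒≈0 : ∀ {n} → m ℕ.∣ n → + n ≈ 0ℤ
  ∣⇒≈0 {n} m∣n = mk≈ (subst (+ m ∣_) (sym (ℤ.+-identityʳ (+ n))) (∣ᵤ⇒∣ m∣n))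

  ≈0⇒∣ : ∀ {n} → + n ≈ 0ℤ → m ℕ.∣ n
  ≈0⇒∣ {n} (mk≈ m∣n-0) = ∣⇒∣ᵤ (subst (+ m ∣_) (ℤ.+-identityʳ (+ n)) m∣n-0)

  m≈0 : + m ≈ 0ℤ
  m≈0 = ∣⇒≈0 ℕ.∣-refl

  ≈-solveʳ : ∀ {a b x w} → a + b + x ≈ w → x ≈ w - a - b
  ≈-solveʳ {a} {b} {x} {w} h = ≈-trans (≡⇒≈ (restore a b x)) (+-cong (+-cong h (≈-refl { - a})) (≈-refl { - b}))
    where
      restore : ∀ a b x → x ≡ a + b + x - a - b
      restore = solve-∀

  recurrence-unique : ∀ L (u v w : ℕ → ℤ) → u 0 ≈ v 0 → u 1 ≈ v 1 →
    (∀ j → 2 ℕ.+ j ℕ.≤ L → u j + u (1 ℕ.+ j) + u (2 ℕ.+ j) ≈ w (2 ℕ.+ j)) →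
    (∀ j → 2 ℕ.+ j ℕ.≤ L → v j + v (1 ℕ.+ j) + v (2 ℕ.+ j) ≈ w (2 ℕ.+ j)) →
    ∀ j → j ℕ.≤ L → u j ≈ v j
  recurrence-unique L u v w u₀≈v₀ u₁≈v₁ rec-u rec-v n n≤L = proj₁ (pair n) n≤L
    where
      pair : ∀ j → (j ℕ.≤ L → u j ≈ v j) × (1 ℕ.+ j ℕ.≤ L → u (1 ℕ.+ j) ≈ v (1 ℕ.+ j))
      pair zero    = (λ _ → u₀≈v₀) , (λ _ → u₁≈v₁)
      pair (suc j) = proj₂ (pair j) , next
        where
          next : 2 ℕ.+ j ℕ.≤ L → u (2 ℕ.+ j) ≈ v (2 ℕ.+ j)
          next 2+j≤L = begin
            u (2 ℕ.+ j)                          ≈⟨ ≈-solveʳ (rec-u j 2+j≤L) ⟩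
            w (2 ℕ.+ j) - u j - u (1 ℕ.+ j)      ≈⟨ +-cong (+-cong (≈-refl {w (2 ℕ.+ j)}) (-‿cong (proj₁ (pair j) j≤L))) (-‿cong (proj₂ (pair j) 1+j≤L)) ⟩
            w (2 ℕ.+ j) - v j - v (1 ℕ.+ j)      ≈⟨ ≈-sym (≈-solveʳ (rec-v j 2+j≤L)) ⟩
            v (2 ℕ.+ j)                          ∎
            where
              open ≈-Reasoning
              1+j≤L : 1 ℕ.+ j ℕ.≤ L
              1+j≤L = ℕ.≤-trans (ℕ.n≤1+n (suc j)) 2+j≤L
              j≤L : j ℕ.≤ L
              j≤L = ℕ.≤-trans (ℕ.n≤1+n j) 1+j≤L

module Lucas (p-1 : ℕ) (prime : Prime (suc p-1)) where

  open import Data.Nat as ℕ using (ℕ; zero; suc; z≤n; s≤s)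
  import Data.Nat.Properties as ℕ
  import Data.Nat.Divisibility as ℕ
  open import Data.Nat.Primality using (euclidsLemma)
  open import Data.Integer as ℤ using (ℤ; +_; -[1+_]; _+_; _-_; -_; _*_; 0ℤ; 1ℤ)
  import Data.Integer.Properties as ℤ
  open import Data.Integer.Tactic.RingSolver using (solve-∀)
  import Data.Nat.Tactic.RingSolver as ℕ-Solver
  open import Data.Sum using (inj₁; inj₂)
  open import Data.Empty using (⊥-elim)
  open import Relation.Nullary using (¬_)
  open import Relation.Binary.Definitions using (tri<; tri≈; tri>)
  open import Relation.Binary.PropositionalEquality
  open import Defs using (sumTo)
  open Binomial
  open Sums using (sumTo-suc)
  open TrinomialSum
  open Trinomial

  p : ℕ
  p = suc p-1

  P : ℤ
  P = + p

  open Congruence p public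

  p∣binom : ∀ {m} → 0 ℕ.< m → m ℕ.< p → p ℕ.∣ binom p m
  p∣binom {suc m} _ m<p with euclidsLemma (suc m) (binom p (suc m)) prime
                                   (ℕ.divides (binom p-1 m) (trans (binom-absorb p-1 m) (ℕ.*-comm p _)))
  ... | inj₁ p∣m = ⊥-elim (ℕ.<⇒≱ m<p (ℕ.∣⇒≤ p∣m))
  ... | inj₂ p∣binom = p∣binom

  p∣sumTo : ∀ B (f : ℕ → ℕ) → (∀ j → p ℕ.∣ f j) → p ℕ.∣ sumTo B f
  p∣sumTo zero    f p∣f = p∣f 0
  p∣sumTo (suc B) f p∣f = ℕ.∣m∣n⇒∣m+n (p∣sumTo B f p∣f) (p∣f (suc B))

  p∣trinomialTerm : ∀ i j → p ℕ.∣ trinomialTerm p i (suc j)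
  p∣trinomialTerm i j with ℕ.<-cmp (i ℕ.+ 2 ℕ.* suc j) p
  ... | tri< lt _ _ = ℕ.∣m⇒∣m*n _ (p∣binom (ℕ.≤-trans (s≤s z≤n) (ℕ.m≤n+m _ i)) lt)
  ... | tri≈ _ eq _ = ℕ.∣n⇒∣m*n (binom p (i ℕ.+ 2 ℕ.* suc j)) (subst (λ m → p ℕ.∣ binom m (suc j)) (sym eq) (p∣binom (s≤s z≤n) (subst (suc j ℕ.<_) eq j<)))
    where
      2*suc≡ : ∀ j → 2 ℕ.* suc j ≡ suc j ℕ.+ suc j
      2*suc≡ = ℕ-Solver.solve-∀
      j< : suc j ℕ.< i ℕ.+ 2 ℕ.* suc j
      j< = ℕ.≤-trans (ℕ.m<m+n (suc j) (s≤s z≤n)) (ℕ.≤-trans (ℕ.≤-reflexive (sym (2*suc≡ j))) (ℕ.m≤n+m _ i))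
  ... | tri> _ _ gt = subst (p ℕ.∣_) (sym (cong (ℕ._* binom (i ℕ.+ 2 ℕ.* suc j) (suc j)) (n<k⇒binom≡0 gt))) (ℕ.divides 0 refl)

  trinomial-p≈binom : ∀ i → trinomial p (+ i) ≈ + binom p i
  trinomial-p≈binom i = begin
    trinomial p (+ i)                                     ≡⟨ trans (trinomial≡trinomialSum p i) (cong +_ (sumTo-suc p-1 (trinomialTerm p i))) ⟩
    + trinomialTerm p i 0 + + sumTo p-1 (λ k → trinomialTerm p i (suc k))
      ≈⟨ +-cong (≈-refl {+ trinomialTerm p i 0}) (∣⇒≈0 (p∣sumTo p-1 _ (p∣trinomialTerm i))) ⟩
    + trinomialTerm p i 0 + 0ℤ                            ≡⟨ trans (ℤ.+-identityʳ _) (cong +_ (trans (ℕ.*-identityʳ _) (cong (binom p) (ℕ.+-identityʳ i)))) ⟩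
    + binom p i                                           ∎
    where open ≈-Reasoning

  δ-≢ : ∀ {i q} → i ≢ q → δ (+ i - + q) ≡ 0ℤ
  δ-≢ {i} {q} i≢q = δ-nonzero (λ i-q≡0 → i≢q (ℤ.+-injective (trans (restore (+ i) (+ q)) (trans (cong (_+ + q) i-q≡0) (ℤ.+-identityˡ (+ q))))))
    where
      restore : ∀ a b → a ≡ a - b + b
      restore = solve-∀
      δ-nonzero : ∀ {x} → ¬ x ≡ 0ℤ → δ x ≡ 0ℤ
      δ-nonzero {+ zero}   x≢0 = ⊥-elim (x≢0 refl)
      δ-nonzero {+ suc n}  _   = refl
      δ-nonzero { -[1+ n ]} _  = refl

  trinomial-p-nonneg : ∀ i → trinomial p (+ i) ≈ δ (+ i) + δ (+ i - P)
  trinomial-p-nonneg zero = trinomial-p≈binom 0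
  trinomial-p-nonneg (suc i) with ℕ.<-cmp (suc i) p
  ... | tri< lt ne _ = begin
    trinomial p (+ suc i)     ≈⟨ trinomial-p≈binom (suc i) ⟩
    + binom p (suc i)         ≈⟨ ∣⇒≈0 (p∣binom (s≤s z≤n) lt) ⟩
    0ℤ                        ≡⟨ sym (trans (ℤ.+-identityˡ _) (δ-≢ ne)) ⟩
    δ (+ suc i) + δ (+ suc i - P) ∎
    where open ≈-Reasoning
  ... | tri≈ _ refl _ = begin
    trinomial p P             ≈⟨ trinomial-p≈binom p ⟩
    + binom p p               ≡⟨ cong +_ (binom-diag p) ⟩
    1ℤ                        ≡⟨ sym (trans (ℤ.+-identityˡ _) (cong δ (ℤ.+-inverseʳ P))) ⟩
    δ P + δ (P - P)           ∎
    where open ≈-Reasoning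
  ... | tri> _ ne gt = begin
    trinomial p (+ suc i)     ≈⟨ trinomial-p≈binom (suc i) ⟩
    + binom p (suc i)         ≡⟨ cong +_ (n<k⇒binom≡0 gt) ⟩
    0ℤ                        ≡⟨ sym (trans (ℤ.+-identityˡ _) (δ-≢ ne)) ⟩
    δ (+ suc i) + δ (+ suc i - P) ∎
    where open ≈-Reasoning

  trinomial-frobenius : ∀ j → trinomial p j ≈ δ (j - P) + δ j + δ (j + P)
  trinomial-frobenius (+ i) = begin
    trinomial p (+ i)                 ≈⟨ trinomial-p-nonneg i ⟩
    δ (+ i) + δ (+ i - P)             ≡⟨ ℤ.+-comm (δ (+ i)) _ ⟩
    δ (+ i - P) + δ (+ i)             ≡⟨ sym (ℤ.+-identityʳ _) ⟩
    δ (+ i - P) + δ (+ i) + 0ℤ        ≡⟨ cong (_+_ (δ (+ i - P) + δ (+ i))) (cong (λ n → δ (+ n)) (sym (ℕ.+-comm i p))) ⟩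
    δ (+ i - P) + δ (+ i) + δ (+ i + P) ∎
    where open ≈-Reasoning
  trinomial-frobenius -[1+ i ] = begin
    trinomial p -[1+ i ]              ≡⟨ trinomial-neg p (+ suc i) ⟩
    trinomial p (+ suc i)             ≈⟨ trinomial-p-nonneg (suc i) ⟩
    0ℤ + δ (+ suc i - P)              ≡⟨ cong (_+_ 0ℤ) (trans (sym (δ-neg (+ suc i - P))) (cong δ (negate (+ suc i) P))) ⟩
    0ℤ + δ (-[1+ i ] + P)             ∎
    where
      open ≈-Reasoning
      negate : ∀ a b → - (a - b) ≡ - a + b
      negate = solve-∀

  trinomial-+p : ∀ n j → trinomial (n ℕ.+ p) j ≈ trinomial n (j - P) + trinomial n j + trinomial n (j + P)
  trinomial-+p zero    j = trinomial-frobenius j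
  trinomial-+p (suc n) j = begin
    T (j - 1ℤ) + T j + T (j + 1ℤ)
      ≈⟨ +-cong (+-cong (trinomial-+p n (j - 1ℤ)) (trinomial-+p n j)) (trinomial-+p n (j + 1ℤ)) ⟩
    (t (j - 1ℤ - P) + t (j - 1ℤ) + t (j - 1ℤ + P)) + (t (j - P) + t j + t (j + P)) + (t (j + 1ℤ - P) + t (j + 1ℤ) + t (j + 1ℤ + P))
      ≡⟨ cong₂ (λ x y → (t x + t (j - 1ℤ) + t y) + (t (j - P) + t j + t (j + P)) + (t (j + 1ℤ - P) + t (j + 1ℤ) + t (j + 1ℤ + P)))
               (swap₋ j P) (swap₊ j P) ⟩
    (t (j - P - 1ℤ) + t (j - 1ℤ) + t (j + P - 1ℤ)) + (t (j - P) + t j + t (j + P)) + (t (j + 1ℤ - P) + t (j + 1ℤ) + t (j + 1ℤ + P))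
      ≡⟨ cong₂ (λ x y → (t (j - P - 1ℤ) + t (j - 1ℤ) + t (j + P - 1ℤ)) + (t (j - P) + t j + t (j + P)) + (t x + t (j + 1ℤ) + t y))
               (swap₋ʳ j P) (swap₊ʳ j P) ⟩
    (t (j - P - 1ℤ) + t (j - 1ℤ) + t (j + P - 1ℤ)) + (t (j - P) + t j + t (j + P)) + (t (j - P + 1ℤ) + t (j + 1ℤ) + t (j + P + 1ℤ))
      ≡⟨ transpose (t (j - P - 1ℤ)) (t (j - P)) (t (j - P + 1ℤ)) (t (j - 1ℤ)) (t j) (t (j + 1ℤ)) (t (j + P - 1ℤ)) (t (j + P)) (t (j + P + 1ℤ)) ⟩
    trinomial (suc n) (j - P) + trinomial (suc n) j + trinomial (suc n) (j + P) ∎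
    where
      open ≈-Reasoning
      T : ℤ → ℤ
      T = trinomial (n ℕ.+ p)
      t : ℤ → ℤ
      t = trinomial n
      swap₋ : ∀ j P → j - 1ℤ - P ≡ j - P - 1ℤ
      swap₋ = solve-∀
      swap₊ : ∀ j P → j - 1ℤ + P ≡ j + P - 1ℤ
      swap₊ = solve-∀
      swap₋ʳ : ∀ j P → j + 1ℤ - P ≡ j - P + 1ℤ
      swap₋ʳ = solve-∀
      swap₊ʳ : ∀ j P → j + 1ℤ + P ≡ j + P + 1ℤ
      swap₊ʳ = solve-∀
      transpose : ∀ a b c d e f g h i → (a + d + g) + (b + e + h) + (c + f + i) ≡ (a + b + c) + (d + e + f) + (g + h + i)
      transpose = solve-∀

  trinomial-lucas₀ : ∀ s q r → s ℕ.< p → r ℕ.< p →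
    trinomial s (P * q + + r) ≡ δ q * trinomial s (+ r) + δ (q + 1ℤ) * trinomial s (+ r - P)
  trinomial-lucas₀ s (+ zero) r _ _ =
    trans (cong (λ z → trinomial s (z + + r)) (ℤ.*-zeroʳ P)) (pick (trinomial s (+ r)) (trinomial s (+ r - P)))
    where
      pick : ∀ x y → x ≡ 1ℤ * x + 0ℤ * y
      pick = solve-∀
  trinomial-lucas₀ s (+ suc q) r s<p _ =
    trans (cong (λ z → trinomial s (z + + r)) (sym (ℤ.pos-* p (suc q))))
          (trinomial-out (ℕ.≤-trans s<p (ℕ.≤-trans (ℕ.m≤m*n p (suc q)) (ℕ.m≤m+n _ r))))
  trinomial-lucas₀ s -[1+ zero ] r _ _ =
    trans (cong (trinomial s) (minus-P P (+ r))) (pick (trinomial s (+ r)) (trinomial s (+ r - P)))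
    where
      minus-P : ∀ P r → P * - 1ℤ + r ≡ r - P
      minus-P = solve-∀
      pick : ∀ x y → y ≡ 0ℤ * x + 1ℤ * y
      pick = solve-∀
  trinomial-lucas₀ s -[1+ suc q ] r s<p r<p = trans (cong (trinomial s) index≡) (trinomial-out⁻ s<A∸r)
    where
      A : ℕ
      A = p ℕ.* suc (suc q)
      r≤A : r ℕ.≤ A
      r≤A = ℕ.≤-trans (ℕ.<⇒≤ r<p) (ℕ.m≤m*n p (suc (suc q)))
      index≡ : P * -[1+ suc q ] + + r ≡ - (+ (A ℕ.∸ r))
      index≡ = begin
        P * - (+ suc (suc q)) + + r ≡⟨ cong (_+ + r) (sym (ℤ.neg-distribʳ-* P (+ suc (suc q)))) ⟩
        - (P * + suc (suc q)) + + r ≡⟨ cong (λ z → - z + + r) (sym (ℤ.pos-* p (suc (suc q)))) ⟩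
        - (+ A) + + r               ≡⟨ ℤ.-m+n≡n⊖m A r ⟩
        r ℤ.⊖ A                     ≡⟨ ℤ.⊖-≤ r≤A ⟩
        - (+ (A ℕ.∸ r))             ∎
        where open ≡-Reasoning
      A≡ : ∀ p q → p ℕ.* suc (suc q) ≡ p ℕ.+ p ℕ.+ p ℕ.* q
      A≡ = ℕ-Solver.solve-∀
      s<A∸r : s ℕ.< A ℕ.∸ r
      s<A∸r = ℕ.≤-trans s<p (ℕ.≤-trans (ℕ.≤-reflexive (sym (ℕ.m+n∸n≡m p p)))
                (ℕ.≤-trans (ℕ.∸-monoʳ-≤ (p ℕ.+ p) (ℕ.<⇒≤ r<p))
                  (ℕ.∸-monoˡ-≤ r (ℕ.≤-trans (ℕ.m≤m+n (p ℕ.+ p) (p ℕ.* q)) (ℕ.≤-reflexive (sym (A≡ p q)))))))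

  -- Lucas' theorem for trinomial coefficients, from (x⁻¹ + 1 + x)^p ≡ x⁻ᵖ + 1 + xᵖ.
  trinomial-lucas : ∀ m s q r → s ℕ.< p → r ℕ.< p →
    trinomial (p ℕ.* m ℕ.+ s) (P * q + + r) ≈ trinomial m q * trinomial s (+ r) + trinomial m (q + 1ℤ) * trinomial s (+ r - P)
  trinomial-lucas zero s q r s<p r<p =
    ≡⇒≈ (trans (cong (λ z → trinomial (z ℕ.+ s) (P * q + + r)) (ℕ.*-zeroʳ p)) (trinomial-lucas₀ s q r s<p r<p))
  trinomial-lucas (suc m) s q r s<p r<p = begin
    trinomial (p ℕ.* suc m ℕ.+ s) (P * q + + r)          ≡⟨ cong (λ n → trinomial n (P * q + + r)) (shift p m s) ⟩
    trinomial (N ℕ.+ p) (P * q + + r)                    ≈⟨ trinomial-+p N (P * q + + r) ⟩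
    trinomial N (P * q + + r - P) + trinomial N (P * q + + r) + trinomial N (P * q + + r + P)
      ≡⟨ cong₂ (λ a b → trinomial N a + trinomial N (P * q + + r) + trinomial N b) (down P q (+ r)) (up P q (+ r)) ⟩
    trinomial N (P * (q - 1ℤ) + + r) + trinomial N (P * q + + r) + trinomial N (P * (q + 1ℤ) + + r)
      ≈⟨ +-cong (+-cong (trinomial-lucas m s (q - 1ℤ) r s<p r<p) (trinomial-lucas m s q r s<p r<p)) (trinomial-lucas m s (q + 1ℤ) r s<p r<p) ⟩
    (t (q - 1ℤ) * X + t (q - 1ℤ + 1ℤ) * Y) + (t q * X + t (q + 1ℤ) * Y) + (t (q + 1ℤ) * X + t (q + 1ℤ + 1ℤ) * Y)
      ≡⟨ cong (λ z → (t (q - 1ℤ) * X + t z * Y) + (t q * X + t (q + 1ℤ) * Y) + (t (q + 1ℤ) * X + t (q + 1ℤ + 1ℤ) * Y)) (pred-suc q) ⟩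
    (t (q - 1ℤ) * X + t q * Y) + (t q * X + t (q + 1ℤ) * Y) + (t (q + 1ℤ) * X + t (q + 1ℤ + 1ℤ) * Y)
      ≡⟨ collect (t (q - 1ℤ)) (t q) (t (q + 1ℤ)) (t (q + 1ℤ + 1ℤ)) X Y ⟩
    trinomial (suc m) q * X + (t q + t (q + 1ℤ) + t (q + 1ℤ + 1ℤ)) * Y
      ≡⟨ cong (λ z → trinomial (suc m) q * X + (t z + t (q + 1ℤ) + t (q + 1ℤ + 1ℤ)) * Y) (sym (suc-pred q)) ⟩
    trinomial (suc m) q * X + trinomial (suc m) (q + 1ℤ) * Y ∎
    where
      open ≈-Reasoning
      N : ℕ
      N = p ℕ.* m ℕ.+ s
      t : ℤ → ℤ
      t = trinomial m
      X : ℤ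
      X = trinomial s (+ r)
      Y : ℤ
      Y = trinomial s (+ r - P)
      shift : ∀ p m s → p ℕ.* suc m ℕ.+ s ≡ p ℕ.* m ℕ.+ s ℕ.+ p
      shift = ℕ-Solver.solve-∀
      down : ∀ P q r → P * q + r - P ≡ P * (q - 1ℤ) + r
      down = solve-∀
      up : ∀ P q r → P * q + r + P ≡ P * (q + 1ℤ) + r
      up = solve-∀
      pred-suc : ∀ q → q - 1ℤ + 1ℤ ≡ q
      pred-suc = solve-∀
      suc-pred : ∀ q → q + 1ℤ - 1ℤ ≡ q
      suc-pred = solve-∀
      collect : ∀ a b c d X Y → (a * X + b * Y) + (b * X + c * Y) + (c * X + d * Y) ≡ (a + b + c) * X + (b + c + d) * Y
      collect = solve-∀

-- invₖ j is the coefficient of x^j in (1 + x + x²)^(−k) = ((1 − x) / (1 − x³))^k,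
-- and the Δ-sequences are the period-3 increments invₖ (j + 3) − invₖ j.
module InversePowers where

  open import Data.Nat as ℕ using (ℕ; zero; suc)
  import Data.Nat.Properties as ℕ
  open import Data.Integer using (ℤ; +_; -[1+_]; _+_; -_; _*_; 0ℤ; 1ℤ)
  import Data.Integer.Properties as ℤ
  open import Data.Integer.Tactic.RingSolver using (solve-∀)
  open import Relation.Binary.PropositionalEquality

  inv₁ : ℕ → ℤ
  inv₁ 0 = 1ℤ
  inv₁ 1 = -[1+ 0 ]
  inv₁ 2 = 0ℤ
  inv₁ (suc (suc (suc j))) = inv₁ j

  inv₂-Δ : ℕ → ℤ
  inv₂-Δ 0 = 1ℤ
  inv₂-Δ 1 = -[1+ 1 ]
  inv₂-Δ 2 = 1ℤ
  inv₂-Δ (suc (suc (suc j))) = inv₂-Δ j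

  inv₂ : ℕ → ℤ
  inv₂ 0 = 1ℤ
  inv₂ 1 = -[1+ 1 ]
  inv₂ 2 = 1ℤ
  inv₂ (suc (suc (suc j))) = inv₂ j + inv₂-Δ j

  inv₃-ΔΔ : ℕ → ℤ
  inv₃-ΔΔ 0 = 0ℤ
  inv₃-ΔΔ 1 = -[1+ 2 ]
  inv₃-ΔΔ 2 = + 3
  inv₃-ΔΔ (suc (suc (suc j))) = inv₃-ΔΔ j

  inv₃-Δ : ℕ → ℤ
  inv₃-Δ 0 = 1ℤ
  inv₃-Δ 1 = -[1+ 5 ]
  inv₃-Δ 2 = + 6
  inv₃-Δ (suc (suc (suc j))) = inv₃-Δ j + inv₃-ΔΔ j

  inv₃ : ℕ → ℤ
  inv₃ 0 = 1ℤ
  inv₃ 1 = -[1+ 2 ]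
  inv₃ 2 = + 3
  inv₃ (suc (suc (suc j))) = inv₃ j + inv₃-Δ j

  private
    interchange : ∀ a b c d e f → (a + d) + (b + e) + (c + f) ≡ (a + b + c) + (d + e + f)
    interchange = solve-∀

  inv₁-recurrence : ∀ j → inv₁ j + inv₁ (1 ℕ.+ j) + inv₁ (2 ℕ.+ j) ≡ 0ℤ
  inv₁-recurrence 0 = refl
  inv₁-recurrence 1 = refl
  inv₁-recurrence 2 = refl
  inv₁-recurrence (suc (suc (suc j))) = inv₁-recurrence j

  inv₂-Δ-recurrence : ∀ j → inv₂-Δ j + inv₂-Δ (1 ℕ.+ j) + inv₂-Δ (2 ℕ.+ j) ≡ 0ℤ
  inv₂-Δ-recurrence 0 = refl
  inv₂-Δ-recurrence 1 = refl
  inv₂-Δ-recurrence 2 = refl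
  inv₂-Δ-recurrence (suc (suc (suc j))) = inv₂-Δ-recurrence j

  inv₂-recurrence : ∀ j → inv₂ j + inv₂ (1 ℕ.+ j) + inv₂ (2 ℕ.+ j) ≡ inv₁ (2 ℕ.+ j)
  inv₂-recurrence 0 = refl
  inv₂-recurrence 1 = refl
  inv₂-recurrence 2 = refl
  inv₂-recurrence (suc (suc (suc j))) =
    trans (interchange (inv₂ j) (inv₂ (1 ℕ.+ j)) (inv₂ (2 ℕ.+ j)) (inv₂-Δ j) (inv₂-Δ (1 ℕ.+ j)) (inv₂-Δ (2 ℕ.+ j)))
          (trans (cong₂ _+_ (inv₂-recurrence j) (inv₂-Δ-recurrence j)) (ℤ.+-identityʳ _))

  inv₃-ΔΔ-recurrence : ∀ j → inv₃-ΔΔ j + inv₃-ΔΔ (1 ℕ.+ j) + inv₃-ΔΔ (2 ℕ.+ j) ≡ 0ℤ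
  inv₃-ΔΔ-recurrence 0 = refl
  inv₃-ΔΔ-recurrence 1 = refl
  inv₃-ΔΔ-recurrence 2 = refl
  inv₃-ΔΔ-recurrence (suc (suc (suc j))) = inv₃-ΔΔ-recurrence j

  inv₃-Δ-recurrence : ∀ j → inv₃-Δ j + inv₃-Δ (1 ℕ.+ j) + inv₃-Δ (2 ℕ.+ j) ≡ inv₂-Δ (2 ℕ.+ j)
  inv₃-Δ-recurrence 0 = refl
  inv₃-Δ-recurrence 1 = refl
  inv₃-Δ-recurrence 2 = refl
  inv₃-Δ-recurrence (suc (suc (suc j))) =
    trans (interchange (inv₃-Δ j) (inv₃-Δ (1 ℕ.+ j)) (inv₃-Δ (2 ℕ.+ j)) (inv₃-ΔΔ j) (inv₃-ΔΔ (1 ℕ.+ j)) (inv₃-ΔΔ (2 ℕ.+ j)))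
          (trans (cong₂ _+_ (inv₃-Δ-recurrence j) (inv₃-ΔΔ-recurrence j)) (ℤ.+-identityʳ _))

  inv₃-recurrence : ∀ j → inv₃ j + inv₃ (1 ℕ.+ j) + inv₃ (2 ℕ.+ j) ≡ inv₂ (2 ℕ.+ j)
  inv₃-recurrence 0 = refl
  inv₃-recurrence 1 = refl
  inv₃-recurrence 2 = refl
  inv₃-recurrence (suc (suc (suc j))) =
    trans (interchange (inv₃ j) (inv₃ (1 ℕ.+ j)) (inv₃ (2 ℕ.+ j)) (inv₃-Δ j) (inv₃-Δ (1 ℕ.+ j)) (inv₃-Δ (2 ℕ.+ j)))
          (cong₂ _+_ (inv₃-recurrence j) (inv₃-Δ-recurrence j))

  inv₁[3b] : ∀ b → inv₁ (b ℕ.* 3) ≡ 1ℤ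
  inv₁[3b] zero    = refl
  inv₁[3b] (suc b) = inv₁[3b] b

  inv₁[1+3b] : ∀ b → inv₁ (1 ℕ.+ b ℕ.* 3) ≡ - 1ℤ
  inv₁[1+3b] zero    = refl
  inv₁[1+3b] (suc b) = inv₁[1+3b] b

  inv₁[2+3b] : ∀ b → inv₁ (2 ℕ.+ b ℕ.* 3) ≡ 0ℤ
  inv₁[2+3b] zero    = refl
  inv₁[2+3b] (suc b) = inv₁[2+3b] b

  inv₂-Δ[3b] : ∀ b → inv₂-Δ (b ℕ.* 3) ≡ 1ℤ
  inv₂-Δ[3b] zero    = refl
  inv₂-Δ[3b] (suc b) = inv₂-Δ[3b] b

  inv₂-Δ[1+3b] : ∀ b → inv₂-Δ (1 ℕ.+ b ℕ.* 3) ≡ -[1+ 1 ]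
  inv₂-Δ[1+3b] zero    = refl
  inv₂-Δ[1+3b] (suc b) = inv₂-Δ[1+3b] b

  inv₂-Δ[2+3b] : ∀ b → inv₂-Δ (2 ℕ.+ b ℕ.* 3) ≡ 1ℤ
  inv₂-Δ[2+3b] zero    = refl
  inv₂-Δ[2+3b] (suc b) = inv₂-Δ[2+3b] b

  inv₂[3b] : ∀ b → inv₂ (b ℕ.* 3) ≡ + suc b
  inv₂[3b] zero    = refl
  inv₂[3b] (suc b) = trans (cong₂ _+_ (inv₂[3b] b) (inv₂-Δ[3b] b)) (cong +_ (ℕ.+-comm (suc b) 1))

  inv₂[1+3b] : ∀ b → inv₂ (1 ℕ.+ b ℕ.* 3) ≡ - (+ 2 * + suc b)
  inv₂[1+3b] zero    = refl
  inv₂[1+3b] (suc b) = trans (cong₂ _+_ (inv₂[1+3b] b) (inv₂-Δ[1+3b] b))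
                             (trans (step (+ suc b)) (cong (λ z → - (+ 2 * + z)) (ℕ.+-comm (suc b) 1)))
    where
      step : ∀ x → - (+ 2 * x) + - (+ 2) ≡ - (+ 2 * (x + 1ℤ))
      step = solve-∀

  inv₂[2+3b] : ∀ b → inv₂ (2 ℕ.+ b ℕ.* 3) ≡ + suc b
  inv₂[2+3b] zero    = refl
  inv₂[2+3b] (suc b) = trans (cong₂ _+_ (inv₂[2+3b] b) (inv₂-Δ[2+3b] b)) (cong +_ (ℕ.+-comm (suc b) 1))

  private
    swap-middle : ∀ a b c d → a + c + (b + d) ≡ (a + b) + (c + d)
    swap-middle = solve-∀

  inv₃-ΔΔ[1+3b]+inv₃-ΔΔ[2+3b] : ∀ b → inv₃-ΔΔ (1 ℕ.+ b ℕ.* 3) + inv₃-ΔΔ (2 ℕ.+ b ℕ.* 3) ≡ 0ℤ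
  inv₃-ΔΔ[1+3b]+inv₃-ΔΔ[2+3b] zero    = refl
  inv₃-ΔΔ[1+3b]+inv₃-ΔΔ[2+3b] (suc b) = inv₃-ΔΔ[1+3b]+inv₃-ΔΔ[2+3b] b

  inv₃-Δ[1+3b]+inv₃-Δ[2+3b] : ∀ b → inv₃-Δ (1 ℕ.+ b ℕ.* 3) + inv₃-Δ (2 ℕ.+ b ℕ.* 3) ≡ 0ℤ
  inv₃-Δ[1+3b]+inv₃-Δ[2+3b] zero    = refl
  inv₃-Δ[1+3b]+inv₃-Δ[2+3b] (suc b) =
    trans (swap-middle (inv₃-Δ (1 ℕ.+ b ℕ.* 3)) (inv₃-Δ (2 ℕ.+ b ℕ.* 3)) (inv₃-ΔΔ (1 ℕ.+ b ℕ.* 3)) (inv₃-ΔΔ (2 ℕ.+ b ℕ.* 3)))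
          (cong₂ _+_ (inv₃-Δ[1+3b]+inv₃-Δ[2+3b] b) (inv₃-ΔΔ[1+3b]+inv₃-ΔΔ[2+3b] b))

  inv₃[1+3b]+inv₃[2+3b] : ∀ b → inv₃ (1 ℕ.+ b ℕ.* 3) + inv₃ (2 ℕ.+ b ℕ.* 3) ≡ 0ℤ
  inv₃[1+3b]+inv₃[2+3b] zero    = refl
  inv₃[1+3b]+inv₃[2+3b] (suc b) =
    trans (swap-middle (inv₃ (1 ℕ.+ b ℕ.* 3)) (inv₃ (2 ℕ.+ b ℕ.* 3)) (inv₃-Δ (1 ℕ.+ b ℕ.* 3)) (inv₃-Δ (2 ℕ.+ b ℕ.* 3)))
          (cong₂ _+_ (inv₃[1+3b]+inv₃[2+3b] b) (inv₃-Δ[1+3b]+inv₃-Δ[2+3b] b))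

module PowerCoefficients (k : ℕ) (prime : Prime (5 Data.Nat.+ k)) where

  open import Data.Nat as ℕ using (ℕ; suc; z≤n; s≤s)
  import Data.Nat.Properties as ℕ
  open import Data.Integer using (ℤ; +_; _+_; _-_; -_; 0ℤ; 1ℤ)
  import Data.Integer.Properties as ℤ
  open import Data.Integer.Tactic.RingSolver using (solve-∀)
  open import Relation.Binary.PropositionalEquality
  open Trinomial
  open Lucas (4 ℕ.+ k) prime public
  open InversePowers

  p-1 p-2 p-3 : ℕ
  p-1 = 4 ℕ.+ k
  p-2 = 3 ℕ.+ k
  p-3 = 2 ℕ.+ k

  -- coeff n j is the coefficient of x^j in (1 + x + x²)^n.
  coeff : ℕ → ℕ → ℤ
  coeff n j = trinomial n (+ j - + n)

  coeff≡trinomial : ∀ i j → coeff (i ℕ.+ j) j ≡ trinomial (i ℕ.+ j) (+ i)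
  coeff≡trinomial i j = trans (cong (trinomial (i ℕ.+ j)) (reflect (+ i) (+ j))) (trinomial-neg (i ℕ.+ j) (+ i))
    where
      reflect : ∀ i j → j - (i + j) ≡ - i
      reflect = solve-∀

  coeff-0 : ∀ n → coeff n 0 ≡ 1ℤ
  coeff-0 n = trans (cong (trinomial n) (ℤ.+-identityˡ (- + n))) (trans (trinomial-neg n (+ n)) (trinomial-top n))

  coeff-pascal : ∀ n j → coeff (suc n) (2 ℕ.+ j) ≡ coeff n j + coeff n (1 ℕ.+ j) + coeff n (2 ℕ.+ j)
  coeff-pascal n j =
    cong₂ _+_ (cong₂ _+_ (cong (trinomial n) (lower (+ j) (+ n))) (cong (trinomial n) (middle (+ j) (+ n))))
              (cong (trinomial n) (upper (+ j) (+ n)))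
    where
      lower : ∀ j n → + 2 + j - (1ℤ + n) - 1ℤ ≡ j - n
      lower = solve-∀
      middle : ∀ j n → + 2 + j - (1ℤ + n) ≡ 1ℤ + j - n
      middle = solve-∀
      upper : ∀ j n → + 2 + j - (1ℤ + n) + 1ℤ ≡ + 2 + j - n
      upper = solve-∀

  coeff-pascal₁ : ∀ n → coeff (suc n) 1 ≡ coeff n 0 + coeff n 1
  coeff-pascal₁ n = begin
    trinomial n (1ℤ - (1ℤ + + n) - 1ℤ) + trinomial n (1ℤ - (1ℤ + + n)) + trinomial n (1ℤ - (1ℤ + + n) + 1ℤ)
      ≡⟨ cong₃ (λ a b c → trinomial n a + trinomial n b + trinomial n c) (lower (+ n)) (middle (+ n)) (upper (+ n)) ⟩
    trinomial n (- (+ suc n)) + coeff n 0 + coeff n 1 ≡⟨ cong (λ z → z + coeff n 0 + coeff n 1) (trinomial-out⁻ (ℕ.n<1+n n)) ⟩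
    0ℤ + coeff n 0 + coeff n 1                       ≡⟨ cong (_+ coeff n 1) (ℤ.+-identityˡ (coeff n 0)) ⟩
    coeff n 0 + coeff n 1                            ∎
    where
      open ≡-Reasoning
      cong₃ : ∀ (f : ℤ → ℤ → ℤ → ℤ) {a b c a′ b′ c′} → a ≡ a′ → b ≡ b′ → c ≡ c′ → f a b c ≡ f a′ b′ c′
      cong₃ f refl refl refl = refl
      lower : ∀ n → 1ℤ - (1ℤ + n) - 1ℤ ≡ - (1ℤ + n)
      lower = solve-∀
      middle : ∀ n → 1ℤ - (1ℤ + n) ≡ 0ℤ - n
      middle = solve-∀
      upper : ∀ n → 1ℤ - (1ℤ + n) + 1ℤ ≡ 1ℤ - n
      upper = solve-∀

  coeff-p≈0 : ∀ j → 1 ℕ.≤ j → j ℕ.≤ p-1 → coeff p j ≈ 0ℤ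
  coeff-p≈0 (suc j) _ j≤ = begin
    coeff p (suc j)                                       ≈⟨ trinomial-frobenius (+ suc j - P) ⟩
    δ (+ suc j - P - P) + δ (+ suc j - P) + δ (+ suc j - P + P)
      ≡⟨ cong₂ _+_ (cong₂ _+_ (trans (cong δ (twice (+ suc j) P)) (δ-≢ (λ e → ℕ.<⇒≱ (ℕ.≤-trans (s≤s j≤) (ℕ.m≤m+n p p)) (ℕ.≤-reflexive (sym e)))))
                              (δ-≢ (ℕ.<⇒≢ (s≤s j≤))))
                   (cong δ (cancel (+ suc j) P)) ⟩
    0ℤ                                                    ∎
    where
      open ≈-Reasoning
      twice : ∀ j P → j - P - P ≡ j - (P + P)
      twice = solve-∀
      cancel : ∀ j P → j - P + P ≡ j
      cancel = solve-∀

  private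
    start : ∀ n {w} → coeff (suc n) 1 ≈ w → coeff n 1 ≈ w - 1ℤ
    start n {w} h = ≈-trans (≡⇒≈ (isolate (coeff n 1)))
                            (+-cong (≈-trans (≡⇒≈ (trans (sym (cong (_+ coeff n 1) (coeff-0 n))) (sym (coeff-pascal₁ n)))) h) ≈-refl)
      where
        isolate : ∀ c → c ≡ 1ℤ + c - 1ℤ
        isolate = solve-∀

  coeff[p-1]≈inv₁ : ∀ j → j ℕ.≤ p-1 → coeff p-1 j ≈ inv₁ j
  coeff[p-1]≈inv₁ = recurrence-unique p-1 (coeff p-1) inv₁ (λ _ → 0ℤ)
    (≡⇒≈ (coeff-0 p-1))
    (start p-1 (coeff-p≈0 1 ℕ.≤-refl (s≤s z≤n)))
    (λ j 2+j≤ → ≈-trans (≡⇒≈ (sym (coeff-pascal p-1 j))) (coeff-p≈0 (2 ℕ.+ j) (s≤s z≤n) 2+j≤))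
    (λ j _ → ≡⇒≈ (inv₁-recurrence j))

  coeff[p-2]≈inv₂ : ∀ j → j ℕ.≤ p-1 → coeff p-2 j ≈ inv₂ j
  coeff[p-2]≈inv₂ = recurrence-unique p-1 (coeff p-2) inv₂ inv₁
    (≡⇒≈ (coeff-0 p-2))
    (start p-2 (coeff[p-1]≈inv₁ 1 (s≤s z≤n)))
    (λ j 2+j≤ → ≈-trans (≡⇒≈ (sym (coeff-pascal p-2 j))) (coeff[p-1]≈inv₁ (2 ℕ.+ j) 2+j≤))
    (λ j _ → ≡⇒≈ (inv₂-recurrence j))

  coeff[p-3]≈inv₃ : ∀ j → j ℕ.≤ p-1 → coeff p-3 j ≈ inv₃ j
  coeff[p-3]≈inv₃ = recurrence-unique p-1 (coeff p-3) inv₃ inv₂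
    (≡⇒≈ (coeff-0 p-3))
    (start p-3 (coeff[p-2]≈inv₂ 1 (s≤s z≤n)))
    (λ j 2+j≤ → ≈-trans (≡⇒≈ (sym (coeff-pascal p-3 j))) (coeff[p-2]≈inv₂ (2 ℕ.+ j) 2+j≤))
    (λ j _ → ≡⇒≈ (inv₃-recurrence j))

  private
    trinomial≈ : ∀ {n} (u : ℕ → ℤ) → (∀ j → j ℕ.≤ p-1 → coeff n j ≈ u j) → n ℕ.≤ p-1 →
                 ∀ i j → i ℕ.+ j ≡ n → trinomial n (+ i) ≈ u j
    trinomial≈ u coeff≈u n≤p-1 i j refl =
      ≈-trans (≡⇒≈ (sym (coeff≡trinomial i j))) (coeff≈u j (ℕ.≤-trans (ℕ.m≤n+m j i) n≤p-1))

  trinomial[p-1]≈inv₁ : ∀ i j → i ℕ.+ j ≡ p-1 → trinomial p-1 (+ i) ≈ inv₁ j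
  trinomial[p-1]≈inv₁ = trinomial≈ inv₁ coeff[p-1]≈inv₁ ℕ.≤-refl

  trinomial[p-2]≈inv₂ : ∀ i j → i ℕ.+ j ≡ p-2 → trinomial p-2 (+ i) ≈ inv₂ j
  trinomial[p-2]≈inv₂ = trinomial≈ inv₂ coeff[p-2]≈inv₂ (ℕ.n≤1+n p-2)

  trinomial[p-3]≈inv₃ : ∀ i j → i ℕ.+ j ≡ p-3 → trinomial p-3 (+ i) ≈ inv₃ j
  trinomial[p-3]≈inv₃ = trinomial≈ inv₃ coeff[p-3]≈inv₃ (ℕ.≤-trans (ℕ.n≤1+n p-3) (ℕ.n≤1+n p-2))

module DigitSchemes (k : ℕ) (prime : Prime (5 Data.Nat.+ k)) where

  open import Data.Nat as ℕ using (ℕ; zero; suc; z≤n; s≤s; _%_; _/_)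
  import Data.Nat.Properties as ℕ
  open import Data.Nat.DivMod using (m≡m%n+[m/n]*n)
  open import Data.Integer using (ℤ; +_; _+_; _-_; -_; _*_; 0ℤ; 1ℤ)
  import Data.Integer.Properties as ℤ
  open import Data.Integer.Tactic.RingSolver using (solve-∀)
  open import Data.Bool using (Bool; true; false; not; _∧_; _∨_; T)
  open import Data.Bool.Properties using (∨-identityʳ)
  import Data.Nat.Divisibility as ℕD
  open import Data.Empty using (⊥-elim)
  open import Relation.Binary.PropositionalEquality
  open import Defs using (motzkin)
  open Trinomial
  open PowerCoefficients k prime public

  trinomial[pN+s] : ∀ N s r → s ℕ.< p → r ℕ.< p →
    trinomial (p ℕ.* N ℕ.+ s) (+ r) ≈ trinomial N 0ℤ * trinomial s (+ r) + trinomial N 1ℤ * trinomial s (+ r - P)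
  trinomial[pN+s] N s r s<p r<p =
    ≈-trans (≡⇒≈ (cong (trinomial (p ℕ.* N ℕ.+ s)) (sym (trans (cong (_+ + r) (ℤ.*-zeroʳ P)) (ℤ.+-identityˡ (+ r))))))
            (trinomial-lucas N s 0ℤ r s<p r<p)

  private
    drop : ∀ a b → a + b * 0ℤ ≡ a
    drop = solve-∀

    1-P : 1ℤ - P ≡ - + p-1
    1-P = shift (+ p-1)
      where
        shift : ∀ n → 1ℤ - (1ℤ + n) ≡ - n
        shift = solve-∀

    2-P : + 2 - P ≡ - + p-2
    2-P = shift (+ p-2)
      where
        shift : ∀ n → + 2 - (+ 2 + n) ≡ - n
        shift = solve-∀

  trinomial[pN+s]₀ : ∀ N s → s ℕ.< p → trinomial (p ℕ.* N ℕ.+ s) 0ℤ ≈ trinomial N 0ℤ * trinomial s 0ℤ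
  trinomial[pN+s]₀ N s s<p = ≈-trans (trinomial[pN+s] N s 0 s<p (s≤s z≤n))
    (≡⇒≈ (trans (cong (λ z → trinomial N 0ℤ * trinomial s 0ℤ + trinomial N 1ℤ * z)
                      (trans (cong (trinomial s) (ℤ.+-identityˡ (- P))) (trinomial-out⁻ s<p)))
                (drop (trinomial N 0ℤ * trinomial s 0ℤ) (trinomial N 1ℤ))))

  trinomial[pN+s]₁ : ∀ N s → s ℕ.< p-1 → trinomial (p ℕ.* N ℕ.+ s) 1ℤ ≈ trinomial N 0ℤ * trinomial s 1ℤ
  trinomial[pN+s]₁ N s s<p-1 = ≈-trans (trinomial[pN+s] N s 1 (ℕ.m<n⇒m<1+n s<p-1) (s≤s (s≤s z≤n)))
    (≡⇒≈ (trans (cong (λ z → trinomial N 0ℤ * trinomial s 1ℤ + trinomial N 1ℤ * z)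
                      (trans (cong (trinomial s) 1-P) (trinomial-out⁻ s<p-1)))
                (drop (trinomial N 0ℤ * trinomial s 1ℤ) (trinomial N 1ℤ))))

  trinomial[pN+p-1]₁ : ∀ N → trinomial (p ℕ.* N ℕ.+ p-1) 1ℤ ≈ trinomial N 0ℤ * trinomial p-1 1ℤ + trinomial N 1ℤ
  trinomial[pN+p-1]₁ N = ≈-trans (trinomial[pN+s] N p-1 1 ℕ.≤-refl (s≤s (s≤s z≤n)))
    (≡⇒≈ (cong (_+_ (trinomial N 0ℤ * trinomial p-1 1ℤ))
               (trans (cong (λ z → trinomial N 1ℤ * z) (trans (cong (trinomial p-1) 1-P) (trans (trinomial-neg p-1 (+ p-1)) (trinomial-top p-1))))
                      (ℤ.*-identityʳ (trinomial N 1ℤ)))))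

  trinomial[pN+s]₂ : ∀ N s → s ℕ.< p →
    trinomial (p ℕ.* N ℕ.+ s) (+ 2) ≈ trinomial N 0ℤ * trinomial s (+ 2) + trinomial N 1ℤ * trinomial s (+ p-2)
  trinomial[pN+s]₂ N s s<p = ≈-trans (trinomial[pN+s] N s 2 s<p (s≤s (s≤s (s≤s z≤n))))
    (≡⇒≈ (cong (λ z → trinomial N 0ℤ * trinomial s (+ 2) + trinomial N 1ℤ * z) (trans (cong (trinomial s) 2-P) (trinomial-neg s (+ p-2)))))

  -- By Lucas, M (pN + d) ≡ form x y N when the last digit d is p − 1 or p − 2.
  form : ℤ → ℤ → ℕ → ℤ
  form x y N = x * trinomial N 0ℤ + y * trinomial N 1ℤ

  form-cong : ∀ {x x′} y N → x ≈ x′ → form x y N ≈ form x′ y N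
  form-cong y N x≈x′ = +-cong (*-cong x≈x′ ≈-refl) ≈-refl

  form[pN+p-1] : ∀ x y N → form x y (p ℕ.* N ℕ.+ p-1) ≈ form (form x y p-1) y N
  form[pN+p-1] x y N = ≈-trans (+-cong (*-cong (≈-refl {x}) (trinomial[pN+s]₀ N p-1 ℕ.≤-refl)) (*-cong (≈-refl {y}) (trinomial[pN+p-1]₁ N)))
                               (≡⇒≈ (regroup x y (trinomial N 0ℤ) (trinomial N 1ℤ) (trinomial p-1 0ℤ) (trinomial p-1 1ℤ)))
    where
      regroup : ∀ x y a b u v → x * (a * u) + y * (a * v + b) ≡ (x * u + y * v) * a + y * b
      regroup = solve-∀

  form[pN+s] : ∀ x y N s → s ℕ.< p-1 → form x y (p ℕ.* N ℕ.+ s) ≈ form x y s * trinomial N 0ℤ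
  form[pN+s] x y N s s<p-1 = ≈-trans (+-cong (*-cong (≈-refl {x}) (trinomial[pN+s]₀ N s (ℕ.m<n⇒m<1+n s<p-1))) (*-cong (≈-refl {y}) (trinomial[pN+s]₁ N s s<p-1)))
                                     (≡⇒≈ (regroup x y (trinomial N 0ℤ) (trinomial s 0ℤ) (trinomial s 1ℤ)))
    where
      regroup : ∀ x y a u v → x * (a * u) + y * (a * v) ≡ (x * u + y * v) * a
      regroup = solve-∀

  motzkinℤ : ℕ → ℤ
  motzkinℤ n = trinomial n 0ℤ - trinomial n (+ 2)

  motzkinℤ[pN+p-1] : ∀ N → motzkinℤ (p ℕ.* N ℕ.+ p-1) ≈ form (motzkinℤ p-1) 1ℤ N
  motzkinℤ[pN+p-1] N = begin
    motzkinℤ (p ℕ.* N ℕ.+ p-1)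
      ≈⟨ +-cong (trinomial[pN+s]₀ N p-1 ℕ.≤-refl) (-‿cong (trinomial[pN+s]₂ N p-1 ℕ.≤-refl)) ⟩
    a * trinomial p-1 0ℤ - (a * trinomial p-1 (+ 2) + b * trinomial p-1 (+ p-2))
      ≡⟨ cong (λ z → a * trinomial p-1 0ℤ - (a * trinomial p-1 (+ 2) + b * z)) (trinomial-subtop p-2) ⟩
    a * trinomial p-1 0ℤ - (a * trinomial p-1 (+ 2) + b * (P - 1ℤ))
      ≡⟨ regroup a b (trinomial p-1 0ℤ) (trinomial p-1 (+ 2)) P ⟩
    form (motzkinℤ p-1) 1ℤ N - b * P
      ≈⟨ +-cong (≈-refl {form (motzkinℤ p-1) 1ℤ N}) (-‿cong (*-cong (≈-refl {b}) m≈0)) ⟩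
    form (motzkinℤ p-1) 1ℤ N - b * 0ℤ
      ≡⟨ vanish (form (motzkinℤ p-1) 1ℤ N) b ⟩
    form (motzkinℤ p-1) 1ℤ N ∎
    where
      open ≈-Reasoning
      a : ℤ
      a = trinomial N 0ℤ
      b : ℤ
      b = trinomial N 1ℤ
      regroup : ∀ a b x y P → a * x - (a * y + b * (P - 1ℤ)) ≡ (x - y) * a + 1ℤ * b - b * P
      regroup = solve-∀
      vanish : ∀ f b → f - b * 0ℤ ≡ f
      vanish = solve-∀

  motzkinℤ[pN+p-2] : ∀ N → motzkinℤ (p ℕ.* N ℕ.+ p-2) ≈ form (motzkinℤ p-2) (- 1ℤ) N
  motzkinℤ[pN+p-2] N = begin
    motzkinℤ (p ℕ.* N ℕ.+ p-2)
      ≈⟨ +-cong (trinomial[pN+s]₀ N p-2 (ℕ.n≤1+n p-1)) (-‿cong (trinomial[pN+s]₂ N p-2 (ℕ.n≤1+n p-1))) ⟩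
    a * trinomial p-2 0ℤ - (a * trinomial p-2 (+ 2) + b * trinomial p-2 (+ p-2))
      ≡⟨ cong (λ z → a * trinomial p-2 0ℤ - (a * trinomial p-2 (+ 2) + b * z)) (trinomial-top p-2) ⟩
    a * trinomial p-2 0ℤ - (a * trinomial p-2 (+ 2) + b * 1ℤ)
      ≡⟨ regroup a b (trinomial p-2 0ℤ) (trinomial p-2 (+ 2)) ⟩
    form (motzkinℤ p-2) (- 1ℤ) N ∎
    where
      open ≈-Reasoning
      a : ℤ
      a = trinomial N 0ℤ
      b : ℤ
      b = trinomial N 1ℤ
      regroup : ∀ a b x y → a * x - (a * y + b * 1ℤ) ≡ (x - y) * a + - 1ℤ * b
      regroup = solve-∀

  -- Read from the last base-p digit, N has fewer than K digits p − 1 followed by the digit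
  -- `digit b`, where b flips at each digit p − 1.
  hits : (Bool → ℕ) → ℕ → Bool → ℕ → Bool
  hits digit zero    b N = false
  hits digit (suc K) b N = (N % p ℕ.≡ᵇ digit b) ∨ ((N % p ℕ.≡ᵇ p-1) ∧ hits digit K (not b) (N / p))

  record Scheme (slope start : ℤ) : Set where
    field
      level          : Bool → ℤ
      level-start    : level false ≈ start
      stopDigit      : Bool → ℕ
      stopDigit<p-1  : ∀ b → stopDigit b ℕ.< p-1
      level-carry    : ∀ b → level (not b) ≈ form (level b) slope p-1
      form-stopDigit : ∀ b → form (level b) slope (stopDigit b) ≈ 0ℤ

  N≡p*[N/p]+N%p : ∀ N → N ≡ p ℕ.* (N / p) ℕ.+ N % p
  N≡p*[N/p]+N%p N = trans (m≡m%n+[m/n]*n N p) (trans (ℕ.+-comm (N % p) _) (cong (ℕ._+ N % p) (ℕ.*-comm (N / p) p)))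

  N%p≡ : ∀ {N d} → T (N % p ℕ.≡ᵇ d) → N ≡ p ℕ.* (N / p) ℕ.+ d
  N%p≡ {N} {d} h = trans (N≡p*[N/p]+N%p N) (cong (p ℕ.* (N / p) ℕ.+_) (ℕ.≡ᵇ⇒≡ (N % p) d h))

  module _ {slope start} (S : Scheme slope start) where

    open Scheme S

    scheme-vanishes : ∀ K b N → T (hits stopDigit K b N) → form (level b) slope N ≈ 0ℤ
    scheme-vanishes (suc K) b N h with N % p ℕ.≡ᵇ stopDigit b in at-stop
    ... | true = begin
      form (level b) slope N                                    ≡⟨ cong (form (level b) slope) (N%p≡ {N} (subst T (sym at-stop) _)) ⟩
      form (level b) slope (p ℕ.* (N / p) ℕ.+ stopDigit b)      ≈⟨ form[pN+s] (level b) slope (N / p) (stopDigit b) (stopDigit<p-1 b) ⟩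
      form (level b) slope (stopDigit b) * trinomial (N / p) 0ℤ ≈⟨ *-cong (form-stopDigit b) ≈-refl ⟩
      0ℤ * trinomial (N / p) 0ℤ                                 ≡⟨⟩
      0ℤ                                                        ∎
      where open ≈-Reasoning
    ... | false with N % p ℕ.≡ᵇ p-1 in at-top
    ...   | true = begin
      form (level b) slope N                                    ≡⟨ cong (form (level b) slope) (N%p≡ {N} (subst T (sym at-top) _)) ⟩
      form (level b) slope (p ℕ.* (N / p) ℕ.+ p-1)              ≈⟨ form[pN+p-1] (level b) slope (N / p) ⟩
      form (form (level b) slope p-1) slope (N / p)             ≈⟨ form-cong slope (N / p) (≈-sym (level-carry b)) ⟩
      form (level (not b)) slope (N / p)                        ≈⟨ scheme-vanishes K (not b) (N / p) h ⟩
      0ℤ                                                        ∎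
      where open ≈-Reasoning

  open Scheme

  hitsEither : ∀ {y x y′ x′} → Scheme y x → Scheme y′ x′ → ℕ → ℕ → Bool
  hitsEither A B K n = ((n % p ℕ.≡ᵇ p-1) ∧ hits (stopDigit A) K false (n / p))
                     ∨ ((n % p ℕ.≡ᵇ p-2) ∧ hits (stopDigit B) K false (n / p))

  p∣motzkin : (A : Scheme 1ℤ (motzkinℤ p-1)) (B : Scheme (- 1ℤ) (motzkinℤ p-2)) →
              ∀ K n → T (hitsEither A B K n) → p ℕD.∣ motzkin n
  p∣motzkin A B K n h with n % p ℕ.≡ᵇ p-1 in at-p-1 | n % p ℕ.≡ᵇ p-2 in at-p-2
  ... | true | true = ⊥-elim (ℕ.<⇒≢ (ℕ.n<1+n p-2)
                        (trans (sym (ℕ.≡ᵇ⇒≡ (n % p) p-2 (subst T (sym at-p-2) _))) (ℕ.≡ᵇ⇒≡ (n % p) p-1 (subst T (sym at-p-1) _))))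
  ... | true | false = ≈0⇒∣ (begin
    + motzkin n                                ≡⟨ motzkin≡trinomial₀-trinomial₂ n ⟩
    motzkinℤ n                                 ≡⟨ cong motzkinℤ (N%p≡ {n} (subst T (sym at-p-1) _)) ⟩
    motzkinℤ (p ℕ.* (n / p) ℕ.+ p-1)           ≈⟨ motzkinℤ[pN+p-1] (n / p) ⟩
    form (motzkinℤ p-1) 1ℤ (n / p)             ≈⟨ form-cong 1ℤ (n / p) (≈-sym (level-start A)) ⟩
    form (level A false) 1ℤ (n / p)            ≈⟨ scheme-vanishes A K false (n / p) (subst T (∨-identityʳ _) h) ⟩
    0ℤ                                         ∎)
    where open ≈-Reasoning
  ... | false | true = ≈0⇒∣ (begin
    + motzkin n                                ≡⟨ motzkin≡trinomial₀-trinomial₂ n ⟩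
    motzkinℤ n                                 ≡⟨ cong motzkinℤ (N%p≡ {n} (subst T (sym at-p-2) _)) ⟩
    motzkinℤ (p ℕ.* (n / p) ℕ.+ p-2)           ≈⟨ motzkinℤ[pN+p-2] (n / p) ⟩
    form (motzkinℤ p-2) (- 1ℤ) (n / p)         ≈⟨ form-cong (- 1ℤ) (n / p) (≈-sym (level-start B)) ⟩
    form (level B false) (- 1ℤ) (n / p)        ≈⟨ scheme-vanishes B K false (n / p) h ⟩
    0ℤ                                         ∎)
    where open ≈-Reasoning

module Tally where

  open import Data.Nat using (ℕ; zero; suc; _+_; _<_; _≤_; z≤n; s≤s)
  open import Data.Nat.Properties
  open import Data.Nat.Divisibility using (_∣_; _∣?_; ∣⇒≤)
  open import Data.Bool using (Bool; true; false; T; _∨_)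
  open import Data.Sum using (inj₁; inj₂)
  open import Data.Empty using (⊥-elim)
  open import Data.Unit using (tt)
  open import Relation.Nullary using (yes; no)
  open import Relation.Binary.PropositionalEquality
  open import Defs using (motzkin; countS0)

  𝟙 : Bool → ℕ
  𝟙 true  = 1
  𝟙 false = 0

  tally : (ℕ → Bool) → ℕ → ℕ
  tally f zero    = 0
  tally f (suc n) = tally f n + 𝟙 (f n)

  tally-mono : ∀ f {m n} → m ≤ n → tally f m ≤ tally f n
  tally-mono f {m} {zero}  z≤n = z≤n
  tally-mono f {m} {suc n} m≤1+n with m≤n⇒m<n∨m≡n m≤1+n
  ... | inj₁ (s≤s m≤n) = ≤-trans (tally-mono f m≤n) (m≤m+n _ _)
  ... | inj₂ refl      = ≤-refl

  tally-+ : ∀ f m j → tally f (m + j) ≡ tally f m + tally (λ d → f (m + d)) j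
  tally-+ f m zero    = trans (cong (tally f) (+-identityʳ m)) (sym (+-identityʳ _))
  tally-+ f m (suc j) = trans (cong (tally f) (+-suc m j))
                              (trans (cong (_+ 𝟙 (f (m + j))) (tally-+ f m j)) (+-assoc (tally f m) _ _))

  tally-true : ∀ n → tally (λ _ → true) n ≡ n
  tally-true zero    = refl
  tally-true (suc n) = trans (cong (_+ 1) (tally-true n)) (+-comm n 1)

  𝟙≤tally : ∀ f {i m} → i < m → 𝟙 (f i) ≤ tally f m
  𝟙≤tally f {i} {suc m} (s≤s i≤m) = ≤-trans (m≤n+m (𝟙 (f i)) (tally f i)) (tally-mono f (s≤s i≤m))

  𝟙+𝟙≤tally : ∀ f {i j m} → i < j → j < m → 𝟙 (f i) + 𝟙 (f j) ≤ tally f m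
  𝟙+𝟙≤tally f {i} {j} i<j j<m = ≤-trans (+-monoˡ-≤ (𝟙 (f j)) (𝟙≤tally f i<j)) (tally-mono f j<m)

  𝟙≤𝟙-∨ʳ : ∀ x y → 𝟙 y ≤ 𝟙 (x ∨ y)
  𝟙≤𝟙-∨ʳ true  true  = ≤-refl
  𝟙≤𝟙-∨ʳ true  false = z≤n
  𝟙≤𝟙-∨ʳ false y     = ≤-refl

  𝟙≤𝟙-∨ˡ : ∀ x y → 𝟙 x ≤ 𝟙 (x ∨ y)
  𝟙≤𝟙-∨ˡ true  y = ≤-refl
  𝟙≤𝟙-∨ˡ false y = z≤n

  tally≤countS0 : ∀ {p} (g : ℕ → Bool) → 1 < p → (∀ n → T (g n) → p ∣ motzkin n) → ∀ N → tally g (suc N) ≤ countS0 p N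
  tally≤countS0 {p} g 1<p g⇒p∣ zero with g 0 in g0
  ... | false = z≤n
  ... | true  = ⊥-elim (<⇒≱ 1<p (∣⇒≤ (g⇒p∣ 0 (subst T (sym g0) tt))))
  tally≤countS0 {p} g 1<p g⇒p∣ (suc N) with p ∣? motzkin (suc N) | g (suc N) in gN
  ... | yes _   | true  = ≤-trans (+-monoˡ-≤ 1 (tally≤countS0 g 1<p g⇒p∣ N)) (≤-reflexive (+-comm _ 1))
  ... | yes _   | false = ≤-trans (≤-reflexive (+-identityʳ _)) (≤-trans (tally≤countS0 g 1<p g⇒p∣ N) (n≤1+n _))
  ... | no  p∤M | true  = ⊥-elim (p∤M (g⇒p∣ (suc N) (subst T (sym gN) tt)))
  ... | no  _   | false = ≤-trans (≤-reflexive (+-identityʳ _)) (tally≤countS0 g 1<p g⇒p∣ N)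

module DensityBound (k : ℕ) (prime : Prime (5 Data.Nat.+ k)) where

  open import Data.Nat as ℕ using (ℕ; zero; suc; _+_; _*_; _^_; _<_; _≤_; z≤n; s≤s; _%_; _/_)
  open import Data.Nat.Properties
  open import Data.Nat.DivMod using ([m+kn]%n≡m%n; m<n⇒m%n≡m; +-distrib-/; m*n%n≡0; m*n/n≡m; m<n⇒m/n≡0; m/n*n≤m; m%n<n)
  open import Data.Nat.Tactic.RingSolver using (solve-∀)
  open import Data.Bool using (Bool; true; false; not; _∧_)
  open import Data.Bool.Properties using (T-≡)
  open import Function.Bundles using (Equivalence)
  open import Relation.Binary.PropositionalEquality
  open Tally
  open DigitSchemes k prime using (p; p-1; p-2; hits; hitsEither; Scheme)
  open Scheme

  p*[R+1] : ∀ R → p * suc R ≡ p * R + p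
  p*[R+1] R = trans (*-suc p R) (+-comm p _)

  [pq+r]%p≡r : ∀ q {r} → r < p → (p * q + r) % p ≡ r
  [pq+r]%p≡r q {r} r<p = trans (cong (_% p) (trans (+-comm (p * q) r) (cong (r +_) (*-comm p q))))
                               (trans ([m+kn]%n≡m%n r q p) (m<n⇒m%n≡m r<p))

  [pq+r]/p≡q : ∀ q {r} → r < p → (p * q + r) / p ≡ q
  [pq+r]/p≡q q {r} r<p = trans (cong (λ z → (z + r) / p) (*-comm p q))
                         (trans (+-distrib-/ (q * p) r (subst (_< p) (sym (cong₂ _+_ (m*n%n≡0 q p) (m<n⇒m%n≡m r<p))) r<p))
                         (trans (cong₂ _+_ (m*n/n≡m q p) (m<n⇒m/n≡0 r<p)) (+-identityʳ q)))

  p*[Q/p]≤Q : ∀ Q → p * (Q / p) ≤ Q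
  p*[Q/p]≤Q Q = subst (_≤ Q) (*-comm (Q / p) p) (m/n*n≤m Q p)

  Q≤p*[Q/p]+p-1 : ∀ Q → Q ≤ p * (Q / p) + p-1
  Q≤p*[Q/p]+p-1 Q = subst (_≤ p * (Q / p) + p-1) (sym (DigitSchemes.N≡p*[N/p]+N%p k prime Q))
                          (+-monoʳ-≤ (p * (Q / p)) (≤-pred (m%n<n Q p)))

  ≡ᵇ-refl : ∀ n → (n ℕ.≡ᵇ n) ≡ true
  ≡ᵇ-refl n = Equivalence.to T-≡ (≡⇒≡ᵇ n n refl)

  -- A block of p consecutive numbers contains the two positions i and j.
  tally-blocks : ∀ (f g h : ℕ → Bool) {i j} → i < j → j < p →
    (∀ R → 𝟙 (g R) ≤ 𝟙 (f (p * R + i))) → (∀ R → 𝟙 (h R) ≤ 𝟙 (f (p * R + j))) →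
    ∀ R → tally g R + tally h R ≤ tally f (p * R)
  tally-blocks f g h i<j j<p g⇒f h⇒f zero    = ≤-reflexive (sym (cong (tally f) (*-zeroʳ p)))
  tally-blocks f g h {i} {j} i<j j<p g⇒f h⇒f (suc R) = begin
    (tally g R + 𝟙 (g R)) + (tally h R + 𝟙 (h R))    ≡⟨ interchange (tally g R) (𝟙 (g R)) (tally h R) (𝟙 (h R)) ⟩
    (tally g R + tally h R) + (𝟙 (g R) + 𝟙 (h R))    ≤⟨ +-mono-≤ (tally-blocks f g h i<j j<p g⇒f h⇒f R) (+-mono-≤ (g⇒f R) (h⇒f R)) ⟩
    tally f (p * R) + (𝟙 (f (p * R + i)) + 𝟙 (f (p * R + j))) ≤⟨ +-monoʳ-≤ (tally f (p * R)) (𝟙+𝟙≤tally (λ d → f (p * R + d)) i<j j<p) ⟩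
    tally f (p * R) + tally (λ d → f (p * R + d)) p  ≡⟨ sym (tally-+ f (p * R) p) ⟩
    tally f (p * R + p)                              ≡⟨ cong (tally f) (sym (p*[R+1] R)) ⟩
    tally f (p * suc R)                              ∎
    where
      open ≤-Reasoning
      interchange : ∀ a b c d → a + b + (c + d) ≡ a + c + (b + d)
      interchange = solve-∀

  floorSum : ℕ → ℕ → ℕ
  floorSum zero    Q = 0
  floorSum (suc K) Q = Q / p + floorSum K (Q / p)

  module _ (digit : Bool → ℕ) (digit<p-1 : ∀ b → digit b < p-1) where

    hits-stop : ∀ K b R → 1 ≤ 𝟙 (hits digit (suc K) b (p * R + digit b))
    hits-stop K b R rewrite [pq+r]%p≡r R (<-trans (digit<p-1 b) ≤-refl) | ≡ᵇ-refl (digit b) = ≤-refl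

    hits-carry : ∀ K b R → 𝟙 (hits digit K (not b) R) ≤ 𝟙 (hits digit (suc K) b (p * R + p-1))
    hits-carry K b R rewrite [pq+r]%p≡r R {p-1} ≤-refl | [pq+r]/p≡q R {p-1} ≤-refl | ≡ᵇ-refl p-1 =
      𝟙≤𝟙-∨ʳ (p-1 ℕ.≡ᵇ digit b) (hits digit K (not b) R)

    floorSum≤tally-hits : ∀ K b Q → floorSum K Q ≤ tally (hits digit K b) Q
    floorSum≤tally-hits zero    b Q = z≤n
    floorSum≤tally-hits (suc K) b Q = begin
      Q / p + floorSum K (Q / p)                          ≤⟨ +-monoʳ-≤ (Q / p) (floorSum≤tally-hits K (not b) (Q / p)) ⟩
      Q / p + tally (hits digit K (not b)) (Q / p)          ≡⟨ cong (_+ tally (hits digit K (not b)) (Q / p)) (sym (tally-true (Q / p))) ⟩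
      tally (λ _ → true) (Q / p) + tally (hits digit K (not b)) (Q / p)
        ≤⟨ tally-blocks (hits digit (suc K) b) (λ _ → true) (hits digit K (not b)) (digit<p-1 b) ≤-refl (hits-stop K b) (hits-carry K b) (Q / p) ⟩
      tally (hits digit (suc K) b) (p * (Q / p))            ≤⟨ tally-mono (hits digit (suc K) b) (p*[Q/p]≤Q Q) ⟩
      tally (hits digit (suc K) b) Q                        ∎
      where open ≤-Reasoning

  2*floorSum≤tally-hitsEither : ∀ {y x y′ x′} (A : Scheme y x) (B : Scheme y′ x′) K Q →
    floorSum K (Q / p) + floorSum K (Q / p) ≤ tally (hitsEither A B K) Q
  2*floorSum≤tally-hitsEither A B K Q = begin
    floorSum K (Q / p) + floorSum K (Q / p)
      ≤⟨ +-mono-≤ (floorSum≤tally-hits (stopDigit B) (stopDigit<p-1 B) K false (Q / p)) (floorSum≤tally-hits (stopDigit A) (stopDigit<p-1 A) K false (Q / p)) ⟩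
    tally hitsB (Q / p) + tally hitsA (Q / p)            ≤⟨ tally-blocks f hitsB hitsA ≤-refl ≤-refl at-p-2 at-p-1 (Q / p) ⟩
    tally f (p * (Q / p))                                ≤⟨ tally-mono f (p*[Q/p]≤Q Q) ⟩
    tally f Q                                            ∎
    where
      open ≤-Reasoning
      f : ℕ → Bool
      f = hitsEither A B K
      hitsA : ℕ → Bool
      hitsA = hits (stopDigit A) K false
      hitsB : ℕ → Bool
      hitsB = hits (stopDigit B) K false
      at-p-2 : ∀ R → 𝟙 (hitsB R) ≤ 𝟙 (f (p * R + p-2))
      at-p-2 R rewrite [pq+r]%p≡r R {p-2} (n≤1+n p-1) | [pq+r]/p≡q R {p-2} (n≤1+n p-1) | ≡ᵇ-refl p-2 =
        𝟙≤𝟙-∨ʳ ((p-2 ℕ.≡ᵇ p-1) ∧ hitsA R) (hitsB R)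
      at-p-1 : ∀ R → 𝟙 (hitsA R) ≤ 𝟙 (f (p * R + p-1))
      at-p-1 R rewrite [pq+r]%p≡r R {p-1} ≤-refl | [pq+r]/p≡q R {p-1} ≤-refl | ≡ᵇ-refl p-1 = 𝟙≤𝟙-∨ˡ (hitsA R) _

  floorSum-lower : ∀ K Q → p ^ K * Q ≤ p-1 * p ^ K * floorSum K Q + K * p-1 * p ^ K + Q
  floorSum-lower zero    Q = ≤-reflexive (base p-1 Q)
    where
      base : ∀ n Q → 1 * Q ≡ n * 1 * 0 + 0 * n * 1 + Q
      base = solve-∀
  floorSum-lower (suc K) Q = +-cancelʳ-≤ (p * R) _ _ (begin
    p ^ suc K * Q + p * R                ≤⟨ +-mono-≤ (*-monoʳ-≤ (p ^ suc K) (Q≤p*[Q/p]+p-1 Q)) (p*[Q/p]≤Q Q) ⟩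
    p ^ suc K * (p * R + p-1) + Q        ≡⟨ expand p-1 (p ^ K) R Q ⟩
    p-1 * (p * p ^ K) * R + p * (p ^ K * R) + p-1 * (p * p ^ K) + Q
      ≤⟨ +-monoˡ-≤ Q (+-monoˡ-≤ (p-1 * (p * p ^ K)) (+-monoʳ-≤ (p-1 * (p * p ^ K) * R) (*-monoʳ-≤ p (floorSum-lower K R)))) ⟩
    p-1 * (p * p ^ K) * R + p * (p-1 * p ^ K * floorSum K R + K * p-1 * p ^ K + R) + p-1 * (p * p ^ K) + Q
      ≡⟨ collect p-1 (p ^ K) R Q (floorSum K R) K ⟩
    p-1 * p ^ suc K * floorSum (suc K) Q + suc K * p-1 * p ^ suc K + Q + p * R ∎)
    where
      open ≤-Reasoning
      R : ℕ
      R = Q / p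
      expand : ∀ n z R Q → suc n * z * (suc n * R + n) + Q ≡ n * (suc n * z) * R + suc n * (z * R) + n * (suc n * z) + Q
      expand = solve-∀
      collect : ∀ n z R Q L K → n * (suc n * z) * R + suc n * (n * z * L + K * n * z + R) + n * (suc n * z) + Q
                                ≡ n * (suc n * z) * (R + L) + suc K * n * (suc n * z) + Q + suc n * R
      collect = solve-∀

  n<m^n : ∀ {m} → 2 ≤ m → ∀ n → n < m ^ n
  n<m^n 2≤m zero    = s≤s z≤n
  n<m^n {m} 2≤m (suc n) = begin
    suc (suc n)        ≡⟨ +-comm 1 (suc n) ⟩
    suc n + 1          ≤⟨ +-mono-≤ (n<m^n 2≤m n) (≤-trans (s≤s z≤n) (n<m^n 2≤m n)) ⟩
    m ^ n + m ^ n      ≡⟨ cong (m ^ n +_) (sym (+-identityʳ (m ^ n))) ⟩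
    2 * m ^ n          ≤⟨ *-monoˡ-≤ (m ^ n) 2≤m ⟩
    m * m ^ n          ∎
    where open ≤-Reasoning

  private
    q : ℕ
    q = p * p-1

    2*n≤q*n : ∀ D → 2 * D ≤ q * D
    2*n≤q*n D = *-monoˡ-≤ D (≤-trans (s≤s (s≤s z≤n)) (m≤m*n p p-1))

  -- The constraints on K and N make the error terms 2bqK, 2b(p − 1) and 1/p^K negligible.
  density-inequality : ∀ b K N c → 4 * b ≤ p ^ K → 2 * b * q * K + 2 * b * p ≤ N →
    floorSum K (suc (suc N) / p) + floorSum K (suc (suc N) / p) ≤ c →
    2 * b * suc N ≤ q * b * c + q * suc N
  density-inequality b K N c 4b≤z N-large 2L≤c = *-cancelˡ-≤ z {{m^n≢0 p K}} (begin
    z * (2 * b * D)                                     ≤⟨ *-monoʳ-≤ z (*-monoʳ-≤ (2 * b) (≤-trans (n≤1+n D) (Q≤p*[Q/p]+p-1 Q))) ⟩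
    z * (2 * b * (p * R + p-1))                         ≡⟨ expand z b p-1 R ⟩
    2 * b * p * (z * R) + 2 * b * z * p-1               ≤⟨ +-monoˡ-≤ (2 * b * z * p-1) (*-monoʳ-≤ (2 * b * p) (floorSum-lower K R)) ⟩
    2 * b * p * (p-1 * z * L + K * p-1 * z + R) + 2 * b * z * p-1
                                                        ≡⟨ regroup z b p-1 R L K ⟩
    z * (q * b * (L + L)) + z * (2 * b * q * K) + 2 * b * (p * R) + z * (2 * b * p-1)
      ≤⟨ +-monoˡ-≤ (z * (2 * b * p-1)) (+-mono-≤ (+-monoˡ-≤ (z * (2 * b * q * K)) (*-monoʳ-≤ z (*-monoʳ-≤ (q * b) 2L≤c)))
                                                  (≤-trans (*-monoʳ-≤ (2 * b) (p*[Q/p]≤Q Q)) 2bQ≤zD)) ⟩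
    z * (q * b * c) + z * (2 * b * q * K) + z * D + z * (2 * b * p-1)
                                                        ≡⟨ factor z (q * b * c) (2 * b * q * K) D (2 * b * p-1) ⟩
    z * (q * b * c + (2 * b * q * K + 2 * b * p-1 + D)) ≤⟨ *-monoʳ-≤ z (+-monoʳ-≤ (q * b * c) errors≤qD) ⟩
    z * (q * b * c + q * D)                             ∎)
    where
      open ≤-Reasoning
      z : ℕ
      z = p ^ K
      D : ℕ
      D = suc N
      Q : ℕ
      Q = suc D
      R : ℕ
      R = Q / p
      L : ℕ
      L = floorSum K R
      expand : ∀ z b n R → z * (2 * b * (suc n * R + n)) ≡ 2 * b * suc n * (z * R) + 2 * b * z * n
      expand = solve-∀
      regroup : ∀ z b n R L K → 2 * b * suc n * (n * z * L + K * n * z + R) + 2 * b * z * n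
        ≡ z * (suc n * n * b * (L + L)) + z * (2 * b * (suc n * n) * K) + 2 * b * (suc n * R) + z * (2 * b * n)
      regroup = solve-∀
      factor : ∀ z A B D C → z * A + z * B + z * D + z * C ≡ z * (A + (B + C + D))
      factor = solve-∀
      2bQ≤4bD : ∀ b N → 2 * b * suc (suc N) ≤ 4 * b * suc N
      2bQ≤4bD b N = subst (2 * b * suc (suc N) ≤_) (split b N) (m≤m+n _ _)
        where
          split : ∀ b N → 2 * b * suc (suc N) + 2 * b * N ≡ 4 * b * suc N
          split = solve-∀
      2bQ≤zD : 2 * b * Q ≤ z * D
      2bQ≤zD = ≤-trans (2bQ≤4bD b N) (*-monoˡ-≤ D 4b≤z)
      errors≤qD : 2 * b * q * K + 2 * b * p-1 + D ≤ q * D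
      errors≤qD = begin
        2 * b * q * K + 2 * b * p-1 + D   ≤⟨ +-monoˡ-≤ D (≤-trans (+-monoʳ-≤ (2 * b * q * K) (*-monoʳ-≤ (2 * b) (n≤1+n p-1))) (≤-trans N-large (n≤1+n N))) ⟩
        D + D                             ≡⟨ cong (D +_) (sym (+-identityʳ D)) ⟩
        2 * D                             ≤⟨ 2*n≤q*n D ⟩
        q * D                             ∎

module RationalBound where

  open import Data.Nat as ℕ using (ℕ; suc)
  import Data.Nat.Properties as ℕ
  open import Data.Integer as ℤ using (+_)
  import Data.Integer.Properties as ℤ
  open import Data.Integer.Tactic.RingSolver using (solve-∀)
  open import Data.Rational using (ℚ; toℚᵘ; _-_; _/_; _≤_) renaming (-_ to -ℚ_)
  open import Data.Rational.Properties using (toℚᵘ-cancel-≤; toℚᵘ-homo-+; toℚᵘ-homo‿-; toℚᵘ-fromℚᵘ)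
  open import Data.Rational.Unnormalised as ℚᵘ using (mkℚᵘ; *≤*)
  import Data.Rational.Unnormalised.Properties as ℚᵘ
  open import Data.Product using (Σ; proj₁; proj₂)
  open import Relation.Binary.PropositionalEquality

  -- With q = x + 1, B = β + 1 and D = N + 1 this is 2/q − (α + 1)/B ≤ c/D cleared of denominators.
  ratio-bound : ∀ x α β c N (ε : ℚ) → toℚᵘ ε ≡ mkℚᵘ (+ suc α) β →
    2 ℕ.* suc β ℕ.* suc N ℕ.≤ suc x ℕ.* suc β ℕ.* c ℕ.+ suc x ℕ.* suc N →
    (+ 2) / suc x - ε ≤ (+ c) / suc N
  ratio-bound x α β c N ε ε≡ h =
    toℚᵘ-cancel-≤ (ℚᵘ.≤-respˡ-≃ (ℚᵘ.≃-sym lhs≃) (ℚᵘ.≤-respʳ-≃ (ℚᵘ.≃-sym rhs≃) (*≤* cross-multiplied)))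
    where
      q : ℕ
      q = suc x
      B : ℕ
      B = suc β
      D : ℕ
      D = suc N
      lhs≃ : toℚᵘ ((+ 2) / q - ε) ℚᵘ.≃ mkℚᵘ (+ 2) x ℚᵘ.+ ℚᵘ.- mkℚᵘ (+ suc α) β
      lhs≃ = ℚᵘ.≃-trans (toℚᵘ-homo-+ ((+ 2) / q) (-ℚ ε))
               (ℚᵘ.+-cong (toℚᵘ-fromℚᵘ (mkℚᵘ (+ 2) x)) (ℚᵘ.≃-trans (toℚᵘ-homo‿- ε) (ℚᵘ.-‿cong (ℚᵘ.≃-reflexive ε≡))))
      rhs≃ : toℚᵘ ((+ c) / D) ℚᵘ.≃ mkℚᵘ (+ c) N
      rhs≃ = toℚᵘ-fromℚᵘ (mkℚᵘ (+ c) N)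
      slack : Σ ℕ (λ o → 2 ℕ.* B ℕ.* D ℕ.+ o ≡ q ℕ.* B ℕ.* c ℕ.+ q ℕ.* D)
      slack = ℕ.m≤n⇒∃[o]m+o≡n h
      e : ℕ
      e = proj₁ slack
      pos-*³ : ∀ a b d → + (a ℕ.* b ℕ.* d) ≡ + a ℤ.* + b ℤ.* + d
      pos-*³ a b d = trans (ℤ.pos-* (a ℕ.* b) d) (cong (ℤ._* + d) (ℤ.pos-* a b))
      h′ : + 2 ℤ.* + B ℤ.* + D ℤ.+ + e ≡ + q ℤ.* + B ℤ.* + c ℤ.+ + q ℤ.* + D
      h′ = trans (cong (ℤ._+ + e) (sym (pos-*³ 2 B D)))
                 (trans (cong +_ (proj₂ slack)) (cong₂ ℤ._+_ (pos-*³ q B c) (ℤ.pos-* q D)))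
      isolate : ∀ q B c D → c ℤ.* (q ℤ.* B) ≡ (q ℤ.* B ℤ.* c ℤ.+ q ℤ.* D) ℤ.- q ℤ.* D
      isolate = solve-∀
      rearrange : ∀ q B D E a → (+ 2 ℤ.* B ℤ.* D ℤ.+ E) ℤ.- q ℤ.* D ≡ (+ 2 ℤ.* B ℤ.+ ℤ.- (+ 1 ℤ.+ a) ℤ.* q) ℤ.* D ℤ.+ (E ℤ.+ a ℤ.* q ℤ.* D)
      rearrange = solve-∀
      X : ℤ.ℤ
      X = (+ 2 ℤ.* + B ℤ.+ ℤ.- (+ suc α) ℤ.* + q) ℤ.* + D
      c*qB≡X+slack : + c ℤ.* + (q ℕ.* B) ≡ X ℤ.+ + (e ℕ.+ α ℕ.* q ℕ.* D)
      c*qB≡X+slack = trans (cong (+ c ℤ.*_) (ℤ.pos-* q B)) (trans (isolate (+ q) (+ B) (+ c) (+ D)) (trans (cong (ℤ._- + q ℤ.* + D) (sym h′))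
                       (trans (rearrange (+ q) (+ B) (+ D) (+ e) (+ α)) (cong (λ z → X ℤ.+ (+ e ℤ.+ z)) (sym (pos-*³ α q D))))))
      cross-multiplied : X ℤ.≤ + c ℤ.* + (q ℕ.* B)
      cross-multiplied = subst (X ℤ.≤_) (sym c*qB≡X+slack) (ℤ.i≤i+j X (+ (e ℕ.+ α ℕ.* q ℕ.* D)))

module Density (k : ℕ) (prime : Prime (5 Data.Nat.+ k)) where

  open import Data.Nat as ℕ using (ℕ; suc; _+_; _*_; s≤s; z≤n)
  import Data.Nat.Properties as ℕ
  open import Data.Integer using (+_; 1ℤ; -_)
  open import Data.Rational using (ℚ; mkℚ; Positive; _-_; _/_) renaming (_≤_ to _≤ℚ_)
  open import Data.Product using (∃-syntax; _,_)
  open import Relation.Binary.PropositionalEquality using (refl)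
  open import Defs using (countS0; lowerBound)
  open Tally
  open DigitSchemes k prime
  open DensityBound k prime

  lower-density : (A : Scheme 1ℤ (motzkinℤ p-1)) (B : Scheme (- 1ℤ) (motzkinℤ p-2)) →
    (ε : ℚ) → Positive ε →
    ∃[ N₀ ] ((N : ℕ) → N₀ ℕ.≤ N → lowerBound p - ε ≤ℚ (+ countS0 p (suc N)) / suc N)
  lower-density A B ε@(mkℚ (+ suc α) β _) _ = N₀ , bound
    where
      b : ℕ
      b = suc β
      K : ℕ
      K = 4 * b
      N₀ : ℕ
      N₀ = 2 * b * (p * p-1) * K + 2 * b * p
      bound : (N : ℕ) → N₀ ℕ.≤ N → lowerBound p - ε ≤ℚ (+ countS0 p (suc N)) / suc N
      bound N N₀≤N = RationalBound.ratio-bound (ℕ.pred (p * p-1)) α β (countS0 p (suc N)) N ε refl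
        (density-inequality b K N (countS0 p (suc N)) (ℕ.<⇒≤ (n<m^n (s≤s (s≤s z≤n)) K)) N₀≤N
          (ℕ.≤-trans (2*floorSum≤tally-hitsEither A B K (suc (suc N)))
                     (tally≤countS0 (hitsEither A B K) (s≤s (s≤s z≤n)) (p∣motzkin A B K) (suc N))))

module SchemesP≡1 (a : ℕ) (prime : Prime (5 Data.Nat.+ (2 Data.Nat.+ a Data.Nat.* 3))) where

  open import Data.Nat as ℕ using (ℕ; suc; s≤s; z≤n)
  import Data.Nat.Properties as ℕ
  open import Data.Integer using (ℤ; +_; _+_; _-_; -_; _*_; 0ℤ; 1ℤ)
  import Data.Integer.Properties as ℤ
  open import Data.Integer.Tactic.RingSolver using (solve-∀)
  open import Relation.Binary.PropositionalEquality using (_≡_; refl)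
  open Trinomial
  open InversePowers
  open DigitSchemes (2 ℕ.+ a ℕ.* 3) prime

  T[p-1]₀ : trinomial p-1 0ℤ ≈ 1ℤ
  T[p-1]₀ = ≈-trans (trinomial[p-1]≈inv₁ 0 p-1 refl) (≡⇒≈ (inv₁[3b] (suc (suc a))))

  T[p-1]₁ : trinomial p-1 1ℤ ≈ 0ℤ
  T[p-1]₁ = ≈-trans (trinomial[p-1]≈inv₁ 1 p-2 refl) (≡⇒≈ (inv₁[2+3b] (suc a)))

  T[p-1]₂ : trinomial p-1 (+ 2) ≈ - 1ℤ
  T[p-1]₂ = ≈-trans (trinomial[p-1]≈inv₁ 2 p-3 refl) (≡⇒≈ (inv₁[1+3b] (suc a)))

  T[p-2]₀ : trinomial p-2 0ℤ ≈ + suc (suc a)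
  T[p-2]₀ = ≈-trans (trinomial[p-2]≈inv₂ 0 p-2 refl) (≡⇒≈ (inv₂[2+3b] (suc a)))

  T[p-2]₁ : trinomial p-2 1ℤ ≈ - (+ 2 * + suc (suc a))
  T[p-2]₁ = ≈-trans (trinomial[p-2]≈inv₂ 1 p-3 refl) (≡⇒≈ (inv₂[1+3b] (suc a)))

  T[p-2]₂ : trinomial p-2 (+ 2) ≈ + suc (suc a)
  T[p-2]₂ = ≈-trans (trinomial[p-2]≈inv₂ 2 (1 ℕ.+ (2 ℕ.+ a ℕ.* 3)) refl) (≡⇒≈ (inv₂[3b] (suc a)))

  schemeA : Scheme 1ℤ (motzkinℤ p-1)
  schemeA = record
    { level          = λ _ → + 2
    ; level-start    = ≈-sym (+-cong T[p-1]₀ (-‿cong T[p-1]₂))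
    ; stopDigit      = λ _ → p-2
    ; stopDigit<p-1  = λ _ → ℕ.≤-refl
    ; level-carry    = λ _ → ≈-sym (+-cong (*-cong (≈-refl {+ 2}) T[p-1]₀) (*-cong (≈-refl {1ℤ}) T[p-1]₁))
    ; form-stopDigit = λ _ → ≈-trans (+-cong (*-cong (≈-refl {+ 2}) T[p-2]₀) (*-cong (≈-refl {1ℤ}) T[p-2]₁)) (≡⇒≈ (cancel (+ suc (suc a))))
    }
    where
      cancel : ∀ c → + 2 * c + 1ℤ * - (+ 2 * c) ≡ 0ℤ
      cancel = solve-∀

  schemeB : Scheme (- 1ℤ) (motzkinℤ p-2)
  schemeB = record
    { level          = λ _ → 0ℤ
    ; level-start    = ≈-sym (≈-trans (+-cong T[p-2]₀ (-‿cong T[p-2]₂)) (≡⇒≈ (ℤ.+-inverseʳ (+ suc (suc a)))))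
    ; stopDigit      = λ _ → 0
    ; stopDigit<p-1  = λ _ → s≤s z≤n
    ; level-carry    = λ _ → ≈-sym (≈-trans (+-cong (≈-refl {0ℤ * trinomial p-1 0ℤ}) (*-cong (≈-refl { - 1ℤ}) T[p-1]₁)) (≡⇒≈ (vanish (trinomial p-1 0ℤ))))
    ; form-stopDigit = λ _ → ≈-refl
    }
    where
      vanish : ∀ t → 0ℤ * t + - 1ℤ * 0ℤ ≡ 0ℤ
      vanish = solve-∀

module SchemesP≡2 (a : ℕ) (prime : Prime (5 Data.Nat.+ a Data.Nat.* 3)) where

  open import Data.Nat as ℕ using (ℕ; suc; s≤s; z≤n)
  import Data.Nat.Properties as ℕ
  open import Data.Integer using (ℤ; +_; _+_; _-_; -_; _*_; 0ℤ; 1ℤ)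
  import Data.Integer.Properties as ℤ
  open import Data.Integer.Tactic.RingSolver using (solve-∀)
  open import Data.Bool using (true; false)
  open import Relation.Binary.PropositionalEquality using (_≡_; refl; cong; trans; sym)
  open Trinomial
  open InversePowers
  open DigitSchemes (a ℕ.* 3) prime

  T[p-1]₀ : trinomial p-1 0ℤ ≈ - 1ℤ
  T[p-1]₀ = ≈-trans (trinomial[p-1]≈inv₁ 0 p-1 refl) (≡⇒≈ (inv₁[1+3b] (suc a)))

  T[p-1]₁ : trinomial p-1 1ℤ ≈ 1ℤ
  T[p-1]₁ = ≈-trans (trinomial[p-1]≈inv₁ 1 p-2 refl) (≡⇒≈ (inv₁[3b] (suc a)))

  T[p-1]₂ : trinomial p-1 (+ 2) ≈ 0ℤ
  T[p-1]₂ = ≈-trans (trinomial[p-1]≈inv₁ 2 p-3 refl) (≡⇒≈ (inv₁[2+3b] a))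

  T[p-2]₀ : trinomial p-2 0ℤ ≈ + suc (suc a)
  T[p-2]₀ = ≈-trans (trinomial[p-2]≈inv₂ 0 p-2 refl) (≡⇒≈ (inv₂[3b] (suc a)))

  T[p-2]₁ : trinomial p-2 1ℤ ≈ + suc a
  T[p-2]₁ = ≈-trans (trinomial[p-2]≈inv₂ 1 p-3 refl) (≡⇒≈ (inv₂[2+3b] a))

  T[p-2]₂ : trinomial p-2 (+ 2) ≈ - (+ 2 * + suc a)
  T[p-2]₂ = ≈-trans (trinomial[p-2]≈inv₂ 2 (1 ℕ.+ a ℕ.* 3) refl) (≡⇒≈ (inv₂[1+3b] a))

  T[p-3]₀+T[p-3]₁ : trinomial p-3 0ℤ + trinomial p-3 1ℤ ≈ 0ℤ
  T[p-3]₀+T[p-3]₁ = ≈-trans (+-cong (trinomial[p-3]≈inv₃ 0 p-3 refl) (trinomial[p-3]≈inv₃ 1 (1 ℕ.+ a ℕ.* 3) refl))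
                            (≡⇒≈ (trans (ℤ.+-comm (inv₃ (2 ℕ.+ a ℕ.* 3)) _) (inv₃[1+3b]+inv₃[2+3b] a)))

  P≡5+3a : P ≡ + 5 + + a * + 3
  P≡5+3a = cong (_+_ (+ 5)) (ℤ.pos-* a 3)

  schemeA : Scheme 1ℤ (motzkinℤ p-1)
  schemeA = record
    { level          = λ { false → - 1ℤ ; true → + 2 }
    ; level-start    = ≈-sym (+-cong T[p-1]₀ (-‿cong T[p-1]₂))
    ; stopDigit      = λ { false → 1 ; true → p-2 }
    ; stopDigit<p-1  = λ { false → s≤s (s≤s z≤n) ; true → ℕ.≤-refl }
    ; level-carry    = λ { false → ≈-sym (+-cong (*-cong (≈-refl { - 1ℤ}) T[p-1]₀) (*-cong (≈-refl {1ℤ}) T[p-1]₁))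
                         ; true  → ≈-sym (+-cong (*-cong (≈-refl {+ 2}) T[p-1]₀) (*-cong (≈-refl {1ℤ}) T[p-1]₁)) }
    ; form-stopDigit = λ { false → ≈-refl
                         ; true  → ≈-trans (+-cong (*-cong (≈-refl {+ 2}) T[p-2]₀) (*-cong (≈-refl {1ℤ}) T[p-2]₁))
                                           (≈-trans (≡⇒≈ (trans (p≡ (+ a)) (sym P≡5+3a))) m≈0) }
    }
    where
      p≡ : ∀ a → + 2 * (+ 2 + a) + 1ℤ * (1ℤ + a) ≡ + 5 + a * + 3
      p≡ = solve-∀

  schemeB : Scheme (- 1ℤ) (motzkinℤ p-2)
  schemeB = record
    { level          = λ { false → - 1ℤ ; true → 0ℤ }
    ; level-start    = ≈-sym (≈-trans (+-cong T[p-2]₀ (-‿cong T[p-2]₂))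
                                      (≈-trans (≡⇒≈ (trans (p-1≡ (+ a)) (cong (_- 1ℤ) (sym P≡5+3a)))) (+-cong m≈0 (≈-refl { - 1ℤ}))))
    ; stopDigit      = λ { false → p-3 ; true → 0 }
    ; stopDigit<p-1  = λ { false → ℕ.n≤1+n p-2 ; true → s≤s z≤n }
    ; level-carry    = λ { false → ≈-sym (+-cong (*-cong (≈-refl { - 1ℤ}) T[p-1]₀) (*-cong (≈-refl { - 1ℤ}) T[p-1]₁))
                         ; true  → ≈-sym (≈-trans (+-cong (≈-refl {0ℤ * trinomial p-1 0ℤ}) (*-cong (≈-refl { - 1ℤ}) T[p-1]₁))
                                                  (≡⇒≈ (drop (trinomial p-1 0ℤ)))) }
    ; form-stopDigit = λ { false → ≈-trans (≡⇒≈ (negate (trinomial p-3 0ℤ) (trinomial p-3 1ℤ))) (-‿cong T[p-3]₀+T[p-3]₁)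
                         ; true  → ≈-refl }
    }
    where
      p-1≡ : ∀ a → + 2 + a - - (+ 2 * (1ℤ + a)) ≡ + 5 + a * + 3 - 1ℤ
      p-1≡ = solve-∀
      drop : ∀ t → 0ℤ * t + - 1ℤ * 1ℤ ≡ - 1ℤ
      drop = solve-∀
      negate : ∀ u v → - 1ℤ * u + - 1ℤ * v ≡ - (u + v)
      negate = solve-∀

open import Defs
open import Data.Nat using (ℕ; zero; suc; _≤_; _+_; _*_; z≤n; s≤s)
open import Data.Nat.Divisibility using (divides)
open import Data.Nat.Primality using (Prime; prime⇒irreducible)
open import Data.Nat.Tactic.RingSolver using (solve-∀)
open import Data.Integer using (+_)
open import Data.Rational using (ℚ; Positive; _-_; _/_) renaming (_≤_ to _≤ℚ_)
open import Data.Product using (∃-syntax; _,_)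
open import Data.Sum using (_⊎_; inj₁; inj₂)
open import Data.Empty using (⊥-elim)
open import Relation.Nullary using (¬_)
open import Relation.Binary.PropositionalEquality using (_≡_; refl; cong)

residue-mod-3 : ∀ k → (∃[ a ] k ≡ a * 3) ⊎ (∃[ a ] k ≡ 1 + a * 3) ⊎ (∃[ a ] k ≡ 2 + a * 3)
residue-mod-3 zero = inj₁ (0 , refl)
residue-mod-3 (suc k) with residue-mod-3 k
... | inj₁ (a , k≡)        = inj₂ (inj₁ (a , cong suc k≡))
... | inj₂ (inj₁ (a , k≡)) = inj₂ (inj₂ (a , cong suc k≡))
... | inj₂ (inj₂ (a , k≡)) = inj₁ (suc a , cong suc k≡)

¬prime[6+3a] : ∀ a → ¬ Prime (6 + a * 3)
¬prime[6+3a] a isPrime with prime⇒irreducible isPrime {3} (divides (2 + a) (factor a))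
  where
    factor : ∀ a → 6 + a * 3 ≡ (2 + a) * 3
    factor = solve-∀
... | inj₁ ()
... | inj₂ ()

density-by-residue : ∀ k → Prime (5 + k) → (∃[ a ] k ≡ a * 3) ⊎ (∃[ a ] k ≡ 1 + a * 3) ⊎ (∃[ a ] k ≡ 2 + a * 3) →
  (ε : ℚ) → Positive ε → ∃[ N₀ ] ((N : ℕ) → N₀ ≤ N → lowerBound (5 + k) - ε ≤ℚ (+ countS0 (5 + k) (suc N)) / suc N)
density-by-residue k isPrime (inj₁ (a , refl))        = Density.lower-density (a * 3) isPrime (SchemesP≡2.schemeA a isPrime) (SchemesP≡2.schemeB a isPrime)
density-by-residue k isPrime (inj₂ (inj₁ (a , refl))) = ⊥-elim (¬prime[6+3a] a isPrime)
density-by-residue k isPrime (inj₂ (inj₂ (a , refl))) = Density.lower-density (2 + a * 3) isPrime (SchemesP≡1.schemeA a isPrime) (SchemesP≡1.schemeB a isPrime)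

mainTheorem1 : (p : ℕ) → Prime p → 5 ≤ p →
    (ε : ℚ) → Positive ε →
    ∃[ N₀ ] ((N : ℕ) → N₀ ≤ N →
      lowerBound p - ε ≤ℚ (+ countS0 p (suc N)) / suc N)
mainTheorem1 (suc (suc (suc (suc (suc k))))) isPrime (s≤s (s≤s (s≤s (s≤s (s≤s z≤n))))) = density-by-residue k isPrime (residue-mod-3 k)
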